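{- For every integer $n\geq 5$, $\sigma(K_5-Y_4,n)=4n-4$.
   Context: All graphs are finite and simple. A nonincreasing sequence of nonnegative integers is graphic if it is the degree sequence of some simple graph (a realization). A graphic sequence is potentially $H$-graphic if it has a realization containing $H$ as a subgraph. For a sequence $\pi$, $\sigma(\pi)$ is the sum of its terms. For a graph $H$ and integer $n$, $\sigma(H,n)$ is the smallest even integer $m$ such that every $n$-term graphic sequence $\pi=(d_1,\dots,d_n)$ with all terms positive and $\sigma(\pi)\geq m$ is potentially $H$-graphic. $Y_4$ denotes the tree on $5$ vertices with exactly $3$ leaves, and $K_5-Y_4$ is the graph obtained from $K_5$ by deleting the edge set of a copy of $Y_4$ spanning its 5 vertices. -}

module Defs where

open import Data.Nat using (ℕ; zero; suc; _+_; _*_; _∸_; _≤_; _<_; _≥_)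
open import Data.Nat.Divisibility using (_∣_)
open import Data.Bool using (Bool; true; false; if_then_else_; not; _∧_)
open import Data.Fin using (Fin) renaming (_≤_ to _≤ᶠ_)
open import Data.Fin.Patterns
open import Data.List using (List; map; allFin)
open import Data.Nat.ListAction using (sum)
open import Data.Product using (Σ; ∃; _×_; _,_)
open import Relation.Binary.PropositionalEquality using (_≡_)
open import Relation.Nullary using (¬_)
open import Function.Definitions using (Injective)

record Graph (n : ℕ) : Set where
  field
    adj   : Fin n → Fin n → Bool
    sym   : ∀ i j → adj i j ≡ adj j i
    irref : ∀ i → adj i i ≡ false
open Graph public

deg : ∀ {n} → Graph n → Fin n → ℕ
deg {n} G i = sum (map (λ j → if adj G i j then 1 else 0) (allFin n))

Seq : ℕ → Set
Seq n = Fin n → ℕ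

σ : ∀ {n} → Seq n → ℕ
σ {n} d = sum (map d (allFin n))

Nonincreasing : ∀ {n} → Seq n → Set
Nonincreasing {n} d = ∀ (i j : Fin n) → i ≤ᶠ j → d j ≤ d i

AllPositive : ∀ {n} → Seq n → Set
AllPositive {n} d = ∀ (i : Fin n) → 1 ≤ d i

Realizes : ∀ {n} → Graph n → Seq n → Set
Realizes {n} G d = ∀ (i : Fin n) → deg G i ≡ d i

Graphic : ∀ {n} → Seq n → Set
Graphic {n} d = Nonincreasing d × Σ (Graph n) (λ G → Realizes G d)

SubgraphOf : ∀ {k n} → Graph k → Graph n → Set
SubgraphOf {k} {n} H G =
  Σ (Fin k → Fin n) λ f → Injective _≡_ _≡_ f ×
    (∀ u v → adj H u v ≡ true → adj G (f u) (f v) ≡ true)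

PotentiallyGraphic : ∀ {k n} → Graph k → Seq n → Set
PotentiallyGraphic {k} {n} H d =
  Graphic d × Σ (Graph n) (λ G → Realizes G d × SubgraphOf H G)

Even : ℕ → Set
Even m = 2 ∣ m

SigmaProperty : ∀ {k} → Graph k → ℕ → ℕ → Set
SigmaProperty H n m =
  ∀ (d : Seq n) → Graphic d → AllPositive d → m ≤ σ d → PotentiallyGraphic H d

-- σ(H,n) = m : m is the smallest even integer with the property.
-- (Even integers m ≤ 0 satisfy the property iff m = 0 does, since all
-- sums are ≥ 0, so quantifying over naturals is faithful.)
IsSigma : ∀ {k} → Graph k → ℕ → ℕ → Set
IsSigma H n m =
  Even m × SigmaProperty H n m ×
  (∀ m' → Even m' → m' < m → ¬ SigmaProperty H n m')

-- Y4: tree on 5 vertices with exactly 3 leaves (center 0 adjacent to 1,2,3; 3 adjacent to 4)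
Y4edge : Fin 5 → Fin 5 → Bool
Y4edge 0F 1F = true
Y4edge 1F 0F = true
Y4edge 0F 2F = true
Y4edge 2F 0F = true
Y4edge 0F 3F = true
Y4edge 3F 0F = true
Y4edge 3F 4F = true
Y4edge 4F 3F = true
Y4edge _  _  = false

distinct : Fin 5 → Fin 5 → Bool
distinct 0F 0F = false
distinct 1F 1F = false
distinct 2F 2F = false
distinct 3F 3F = false
distinct 4F 4F = false
distinct _ _ = true

K5-Y4adj : Fin 5 → Fin 5 → Bool
K5-Y4adj i j = distinct i j ∧ not (Y4edge i j)

K5-Y4 : Graph 5
K5-Y4 = record
  { adj = K5-Y4adj
  ; sym = s
  ; irref = r }
  where
  s : ∀ i j → K5-Y4adj i j ≡ K5-Y4adj j i
  s 0F 0F = _≡_.refl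
  s 0F 1F = _≡_.refl
  s 0F 2F = _≡_.refl
  s 0F 3F = _≡_.refl
  s 0F 4F = _≡_.refl
  s 1F 0F = _≡_.refl
  s 1F 1F = _≡_.refl
  s 1F 2F = _≡_.refl
  s 1F 3F = _≡_.refl
  s 1F 4F = _≡_.refl
  s 2F 0F = _≡_.refl
  s 2F 1F = _≡_.refl
  s 2F 2F = _≡_.refl
  s 2F 3F = _≡_.refl
  s 2F 4F = _≡_.refl
  s 3F 0F = _≡_.refl
  s 3F 1F = _≡_.refl
  s 3F 2F = _≡_.refl
  s 3F 3F = _≡_.refl
  s 3F 4F = _≡_.refl
  s 4F 0F = _≡_.refl
  s 4F 1F = _≡_.refl
  s 4F 2F = _≡_.refl
  s 4F 3F = _≡_.refl
  s 4F 4F = _≡_.refl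
  r : ∀ i → K5-Y4adj i i ≡ false
  r 0F = _≡_.refl
  r 1F = _≡_.refl
  r 2F = _≡_.refl
  r 3F = _≡_.refl
  r 4F = _≡_.refl

-- Main lemma: for n ≥ 5, every graph G on n vertices with degree sum at least 4n − 4 has a
-- realization of its degree sequence containing K5 − Y4.  Induction on n, with n = 5 checked
-- exhaustively.  Let v have minimum degree.  If G − v still meets the bound, v is put back into a
-- good realization of G − v.  Otherwise the arithmetic forces deg v = 3 and every degree ≥ 3.
-- If two neighbours x, y of v are non-adjacent, G − v + xy meets the bound and has the degrees of
-- G − v except that the third neighbour z lost one; in a good realization of it, some edge ab
-- avoiding z lies outside the copy, and deleting it and joining v to a, b, z restores the degrees
-- of G.  If v and its neighbours form a K4, either one of them has a further neighbour, which
-- already yields a copy, or the K4 is a component and a 2-switch with an edge outside creates one.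
-- Sharpness: the book K₂ ∨ K̄ₙ₋₂ has degree sum 4n − 6 but only two vertices of degree ≥ 3,
-- whereas K5 − Y4 has three.

module Submission where

open import Defs renaming (sym to adj-sym)

open import Data.Bool using (Bool; true; false; if_then_else_; _∨_; _∧_; T)
open import Data.Bool.Properties using (∨-comm; ∨-identityʳ; T-∧) renaming (_≟_ to _≟ᵇ_)
open import Data.Empty using (⊥)
open import Data.Fin using (Fin; zero; suc; punchIn; punchOut; #_)
open import Data.Fin.Patterns using (0F; 1F; 2F; 3F; 4F)
open import Data.Fin.Properties
  using (any?; all?; ¬∀⟶∃¬; punchInᵢ≢i; punchIn-injective; punchIn-punchOut; punchOut-punchIn; punchOut-cong)
  renaming (_≟_ to _≟ᶠ_)
open import Data.List using (List; []; _∷_; length; map; allFin; tabulate; head; mapMaybe; cartesianProduct)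
import Data.List.Properties as List
open import Data.List.Extrema.Nat using (argmin; f[argmin]≤f[xs])
open import Data.List.Membership.Propositional using (_∈_; _∉_)
open import Data.List.Membership.Propositional.Properties using (∈-allFin; ∈-++⁺ˡ)
open import Data.List.Relation.Unary.All as All using (All; []; _∷_)
open import Data.List.Relation.Unary.AllPairs using (AllPairs; []; _∷_)
open import Data.List.Relation.Unary.Any as Any using (here; there)
open import Data.List.Relation.Unary.Any.Properties using (singleton⁻)
open import Data.Maybe using (Maybe; just; nothing; is-just)
open import Data.Nat using (ℕ; zero; suc; _+_; _*_; _∸_; _≤_; _<_; z≤n; s≤s; _≤?_; _≤′_; ≤′-refl; ≤′-step)
open import Data.Nat.Divisibility using (divides)
import Data.Nat.ListAction as List
open import Data.Nat.Properties
open import Data.Nat.Solver using (module +-*-Solver)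
open import Data.Product using (Σ; ∃; _×_; _,_)
open import Data.Sum using (_⊎_; inj₁; inj₂)
open import Data.Unit using (tt)
open import Data.Vec using (Vec; []; _∷_; lookup)
open import Function using (_∘_; id)
open import Function.Bundles using (Equivalence; mk⇔)
open import Relation.Binary.PropositionalEquality
open import Relation.Nullary using (¬_; Dec; yes; no; contradiction)
open import Relation.Nullary.Decidable
  using (does; toSum; _×-dec_; _⊎-dec_; ¬?; decidable-stable; dec-true; dec-false; does-⇔)

open import Algebra.Properties.CommutativeMonoid.Sum +-0-commutativeMonoid
  using (sum; sum-syntax; sum-cong-≗; sum-remove; ∑-distrib-+)
open +-*-Solver using (solve; _:+_; _:*_; _:=_; con)

-- Sums and counts over Fin

sum-map-allFin : ∀ {n} (f : Fin n → ℕ) → List.sum (map f (allFin n)) ≡ ∑[ i < n ] f i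
sum-map-allFin {zero} f = refl
sum-map-allFin {suc n} f = cong (f zero +_) (begin
  List.sum (map f (tabulate suc))        ≡⟨ cong List.sum (List.map-tabulate suc f) ⟩
  List.sum (tabulate (f ∘ suc))          ≡⟨ cong List.sum (List.map-tabulate id (f ∘ suc)) ⟨
  List.sum (map (f ∘ suc) (allFin n))    ≡⟨ sum-map-allFin (f ∘ suc) ⟩
  ∑[ i < n ] f (suc i)                   ∎)
  where open ≡-Reasoning

sum-mono-≤ : ∀ {n} {f g : Fin n → ℕ} → (∀ i → f i ≤ g i) → sum f ≤ sum g
sum-mono-≤ {zero} f≤g = z≤n
sum-mono-≤ {suc n} f≤g = +-mono-≤ (f≤g zero) (sum-mono-≤ (f≤g ∘ suc))

sum-const : ∀ n c → ∑[ i < n ] c ≡ n * c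
sum-const zero c = refl
sum-const (suc n) c = cong (c +_) (sum-const n c)

sum-agree-except : ∀ {n} (b : Fin n) {f g : Fin n → ℕ} → (∀ j → j ≢ b → f j ≡ g j) →
  sum f + g b ≡ sum g + f b
sum-agree-except {suc n} b {f} {g} f≗g = begin
  sum f + g b                          ≡⟨ cong (_+ g b) (sum-remove {i = b} f) ⟩
  f b + sum (f ∘ punchIn b) + g b      ≡⟨ cong (λ s → f b + s + g b) (sum-cong-≗ (λ j → f≗g _ (punchInᵢ≢i b j))) ⟩
  f b + sum (g ∘ punchIn b) + g b      ≡⟨ solve 3 (λ a s c → a :+ s :+ c := c :+ s :+ a) refl (f b) _ (g b) ⟩
  g b + sum (g ∘ punchIn b) + f b      ≡⟨ cong (_+ f b) (sum-remove {i = b} g) ⟨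
  sum g + f b                          ∎
  where open ≡-Reasoning

ind : Bool → ℕ
ind b = if b then 1 else 0

ind≤1 : ∀ b → ind b ≤ 1
ind≤1 true  = ≤-refl
ind≤1 false = z≤n

count : ∀ {n} → (Fin n → Bool) → ℕ
count {n} g = ∑[ j < n ] ind (g j)

count-true : ∀ n → count {n} (λ _ → true) ≡ n
count-true n = trans (sum-const n 1) (*-identityʳ n)

erase : ∀ {n} → (Fin n → Bool) → Fin n → Fin n → Bool
erase g a j with j ≟ᶠ a
... | yes _ = false
... | no  _ = g j

erase-≡ : ∀ {n} (g : Fin n → Bool) a → erase g a a ≡ false
erase-≡ g a with a ≟ᶠ a
... | yes _  = refl
... | no a≢a = contradiction refl a≢a

erase-≢ : ∀ {n} (g : Fin n → Bool) {a j} → j ≢ a → erase g a j ≡ g j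
erase-≢ g {a} {j} j≢a with j ≟ᶠ a
... | yes j≡a = contradiction j≡a j≢a
... | no  _   = refl

erase-true : ∀ {n} (g : Fin n → Bool) a j → erase g a j ≡ true → j ≢ a × g j ≡ true
erase-true g a j e with j ≟ᶠ a
... | no j≢a = j≢a , e

count-erase : ∀ {n} (g : Fin n → Bool) a → count g ≡ count (erase g a) + ind (g a)
count-erase g a = begin
  count g                         ≡⟨ +-identityʳ _ ⟨
  count g + 0                     ≡⟨ cong (λ b → count g + ind b) (erase-≡ g a) ⟨
  count g + ind (erase g a a)     ≡⟨ sum-agree-except a (λ j j≢a → cong ind (erase-≢ g j≢a)) ⟨
  count (erase g a) + ind (g a)   ∎
  where open ≡-Reasoning

length≤count : ∀ {n} (g : Fin n → Bool) {L : List (Fin n)} →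
  AllPairs _≢_ L → All (λ j → g j ≡ true) L → length L ≤ count g
length≤count g []                 []             = z≤n
length≤count g {a ∷ L} (a∉L ∷ L!) (ga ∷ gL) = begin
  suc (length L)                  ≤⟨ s≤s (length≤count (erase g a) L! (erased gL a∉L)) ⟩
  suc (count (erase g a))         ≡⟨ +-comm 1 _ ⟩
  count (erase g a) + 1           ≡⟨ cong (λ b → count (erase g a) + ind b) ga ⟨
  count (erase g a) + ind (g a)   ≡⟨ count-erase g a ⟨
  count g                         ∎
  where
  open ≤-Reasoning
  erased : ∀ {K} → All (λ j → g j ≡ true) K → All (a ≢_) K → All (λ j → erase g a j ≡ true) K
  erased []         []           = []
  erased (gj ∷ gK)  (a≢j ∷ a≢K) = trans (erase-≢ g (a≢j ∘ sym)) gj ∷ erased gK a≢K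

count≤length : ∀ {n} (g : Fin n → Bool) (L : List (Fin n)) →
  (∀ j → g j ≡ true → j ∈ L) → count g ≤ length L
count≤length {n} g [] g⊆[] = begin
  count g          ≤⟨ sum-mono-≤ none ⟩
  ∑[ j < n ] 0     ≡⟨ sum-const n 0 ⟩
  n * 0            ≡⟨ *-zeroʳ n ⟩
  0                ∎
  where
  open ≤-Reasoning
  none : ∀ j → ind (g j) ≤ 0
  none j with g j in gj
  ... | true  with () ← g⊆[] j gj
  ... | false = z≤n
count≤length g (a ∷ L) g⊆a∷L = begin
  count g                         ≡⟨ count-erase g a ⟩
  count (erase g a) + ind (g a)   ≤⟨ +-mono-≤ (count≤length (erase g a) L erased⊆L) (ind≤1 (g a)) ⟩
  length L + 1                    ≡⟨ +-comm (length L) 1 ⟩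
  suc (length L)                  ∎
  where
  open ≤-Reasoning
  erased⊆L : ∀ j → erase g a j ≡ true → j ∈ L
  erased⊆L j e with erase-true g a j e
  ... | j≢a , gj with g⊆a∷L j gj
  ... | here j≡a  = contradiction j≡a j≢a
  ... | there j∈L = j∈L

_∈?_ : ∀ {n} (j : Fin n) L → Dec (j ∈ L)
j ∈? L = Any.any? (j ≟ᶠ_) L

outside? : ∀ {n} (g : Fin n → Bool) (L : List (Fin n)) →
  (∃ λ j → g j ≡ true × j ∉ L) ⊎ (∀ j → g j ≡ true → j ∈ L)
outside? g L with any? (λ j → (g j ≟ᵇ true) ×-dec ¬? (j ∈? L))
... | yes found = inj₁ found
... | no ¬found = inj₂ λ j gj → decidable-stable (j ∈? L) (λ j∉L → ¬found (j , gj , j∉L))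

outside : ∀ {n} (g : Fin n → Bool) (L : List (Fin n)) → length L < count g →
  ∃ λ j → g j ≡ true × j ∉ L
outside g L L<g with outside? g L
... | inj₁ found = found
... | inj₂ g⊆L   = contradiction (count≤length g L g⊆L) (<⇒≱ L<g)

memberOf : ∀ {n} → List (Fin n) → Fin n → Bool
memberOf L w = does (w ∈? L)

memberOf-∈ : ∀ {n} (L : List (Fin n)) {w} → w ∈ L → memberOf L w ≡ true
memberOf-∈ L {w} = dec-true (w ∈? L)

memberOf-∉ : ∀ {n} (L : List (Fin n)) {w} → w ∉ L → memberOf L w ≡ false
memberOf-∉ L {w} = dec-false (w ∈? L)

memberOf-true : ∀ {n} {L : List (Fin n)} {w} → memberOf L w ≡ true → w ∈ L
memberOf-true {L = L} {w} e with w ∈? L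
... | yes w∈L = w∈L
... | no  _   with () ← e

count-memberOf : ∀ {n} {L : List (Fin n)} → AllPairs _≢_ L → count (memberOf L) ≡ length L
count-memberOf {L = L} L! = ≤-antisym (count≤length _ L (λ _ → memberOf-true))
  (length≤count _ L! (All.tabulate (memberOf-∈ L)))

record ExactlyThree {n} (g : Fin n → Bool) : Set where
  constructor exactlyThree
  field
    x y z : Fin n
    x≢y : x ≢ y
    x≢z : x ≢ z
    y≢z : y ≢ z
    gx  : g x ≡ true
    gy  : g y ≡ true
    gz  : g z ≡ true
    only : ∀ j → g j ≡ true → j ∈ x ∷ y ∷ z ∷ []

count≡3⇒ExactlyThree : ∀ {n} {g : Fin n → Bool} → count g ≡ 3 → ExactlyThree g
count≡3⇒ExactlyThree {g = g} count≡3
  with outside g [] (subst (0 <_) (sym count≡3) (s≤s z≤n))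
... | x , gx , _ with outside g (x ∷ []) (subst (1 <_) (sym count≡3) (s≤s (s≤s z≤n)))
... | y , gy , y∉ with outside g (x ∷ y ∷ []) (subst (2 <_) (sym count≡3) ≤-refl)
... | z , gz , z∉ = exactlyThree x y z x≢y x≢z y≢z gx gy gz only
  where
  x≢y = ≢-sym (y∉ ∘ here)
  x≢z = ≢-sym (z∉ ∘ here)
  y≢z = ≢-sym (z∉ ∘ there ∘ here)
  only : ∀ j → g j ≡ true → j ∈ x ∷ y ∷ z ∷ []
  only j gj with outside? g (x ∷ y ∷ z ∷ [])
  ... | inj₂ g⊆xyz = g⊆xyz j gj
  ... | inj₁ (q , gq , q∉) = contradiction
        (length≤count g ((x≢y ∷ x≢z ∷ ≢-sym (q∉ ∘ here) ∷ []) ∷ (y≢z ∷ ≢-sym (q∉ ∘ there ∘ here) ∷ []) ∷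
                         (≢-sym (q∉ ∘ there ∘ there ∘ here) ∷ []) ∷ [] ∷ [])
                        (gx ∷ gy ∷ gz ∷ gq ∷ []))
        (subst (λ k → ¬ 4 ≤ k) (sym count≡3) (<-irrefl refl))

module _ {n} {g : Fin n → Bool} (T : ExactlyThree g) where
  open ExactlyThree T

  elsewhere-false : ∀ {j} → j ≢ x → j ≢ y → j ≢ z → g j ≡ false
  elsewhere-false {j} j≢x j≢y j≢z with g j in gj
  ... | false = refl
  ... | true with only j gj
  ...   | here j≡x                 = contradiction j≡x j≢x
  ...   | there (here j≡y)         = contradiction j≡y j≢y
  ...   | there (there (here j≡z)) = contradiction j≡z j≢z

  swap-yz : ExactlyThree g
  swap-yz = exactlyThree x z y x≢z x≢y (≢-sym y≢z) gx gz gy only′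
    where
    only′ : ∀ j → g j ≡ true → j ∈ x ∷ z ∷ y ∷ []
    only′ j gj with only j gj
    ... | here j≡x                 = here j≡x
    ... | there (here j≡y)         = there (there (here j≡y))
    ... | there (there (here j≡z)) = there (here j≡z)

  rotate : ExactlyThree g
  rotate = exactlyThree y z x y≢z (≢-sym x≢y) (≢-sym x≢z) gy gz gx only′
    where
    only′ : ∀ j → g j ≡ true → j ∈ y ∷ z ∷ x ∷ []
    only′ j gj with only j gj
    ... | here j≡x                 = there (there (here j≡x))
    ... | there (here j≡y)         = here j≡y
    ... | there (there (here j≡z)) = there (here j≡z)

no-three-among-two : ∀ {A : Set} {u w a b c : A} → a ≢ b → a ≢ c → b ≢ c →
  a ≡ u ⊎ a ≡ w → b ≡ u ⊎ b ≡ w → c ≡ u ⊎ c ≡ w → ⊥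
no-three-among-two a≢b _   _   (inj₁ refl) (inj₁ refl) _           = a≢b refl
no-three-among-two a≢b _   _   (inj₂ refl) (inj₂ refl) _           = a≢b refl
no-three-among-two _   a≢c _   (inj₁ refl) _           (inj₁ refl) = a≢c refl
no-three-among-two _   a≢c _   (inj₂ refl) _           (inj₂ refl) = a≢c refl
no-three-among-two _   _   b≢c _           (inj₁ refl) (inj₁ refl) = b≢c refl
no-three-among-two _   _   b≢c _           (inj₂ refl) (inj₂ refl) = b≢c refl

degSum : ∀ {n} → Graph n → ℕ
degSum {n} G = ∑[ i < n ] deg G i

SameDegrees : ∀ {n} → Graph n → Graph n → Set
SameDegrees G H = ∀ i → deg G i ≡ deg H i

deg≡count : ∀ {n} (G : Graph n) i → deg G i ≡ count (adj G i)
deg≡count G i = sum-map-allFin (λ j → ind (adj G i j))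

≗adj⇒SameDegrees : ∀ {n} {G H : Graph n} → (∀ i j → adj G i j ≡ adj H i j) → SameDegrees G H
≗adj⇒SameDegrees {G = G} {H} G≗H i = begin
  deg G i          ≡⟨ deg≡count G i ⟩
  count (adj G i)  ≡⟨ sum-cong-≗ (cong ind ∘ G≗H i) ⟩
  count (adj H i)  ≡⟨ deg≡count H i ⟨
  deg H i          ∎
  where open ≡-Reasoning

degSum≤ : ∀ {n} (G : Graph n) {d} → (∀ w → deg G w ≤ d) → degSum G ≤ n * d
degSum≤ {n} G {d} deg≤d = ≤-trans (sum-mono-≤ deg≤d) (≤-reflexive (sum-const n d))

degSum≥ : ∀ {n} (G : Graph n) {d} → (∀ w → d ≤ deg G w) → n * d ≤ degSum G
degSum≥ {n} G {d} d≤deg = ≤-trans (≤-reflexive (sym (sum-const n d))) (sum-mono-≤ d≤deg)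

min-degree-vertex : ∀ {m} (G : Graph (suc m)) → ∃ λ v → ∀ w → deg G v ≤ deg G w
min-degree-vertex {m} G = argmin (deg G) zero (allFin (suc m)) ,
  λ w → All.lookup (f[argmin]≤f[xs] {f = deg G} zero (allFin (suc m))) (∈-allFin w)

edge-sym : ∀ {n} (G : Graph n) {i j} → adj G i j ≡ true → adj G j i ≡ true
edge-sym G {i} {j} e = trans (adj-sym G j i) e

edge⇒≢ : ∀ {n} (G : Graph n) {i j} → adj G i j ≡ true → i ≢ j
edge⇒≢ G {i} e refl with () ← trans (sym e) (irref G i)

non-neighbour-≢ : ∀ {n} (G : Graph n) {a b q} → adj G a b ≡ false → adj G a q ≡ true → q ≢ b
non-neighbour-≢ G ab aq refl with () ← trans (sym ab) aq

three-neighbours⇒3≤deg : ∀ {n} (G : Graph n) {w a b c} → a ≢ b → a ≢ c → b ≢ c →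
  adj G w a ≡ true → adj G w b ≡ true → adj G w c ≡ true → 3 ≤ deg G w
three-neighbours⇒3≤deg G {w} a≢b a≢c b≢c wa wb wc = subst (3 ≤_) (sym (deg≡count G w))
  (length≤count (adj G w) ((a≢b ∷ a≢c ∷ []) ∷ (b≢c ∷ []) ∷ [] ∷ []) (wa ∷ wb ∷ wc ∷ []))

neighbour-outside : ∀ {n} (G : Graph n) w (L : List (Fin n)) → length L < deg G w →
  ∃ λ q → adj G w q ≡ true × q ∉ L
neighbour-outside G w L L<deg = outside (adj G w) L (subst (length L <_) (deg≡count G w) L<deg)

deg≤length : ∀ {n} (G : Graph n) w (L : List (Fin n)) → (∀ q → adj G w q ≡ true → q ∈ L) →
  deg G w ≤ length L
deg≤length G w L N⊆L = subst (_≤ length L) (sym (deg≡count G w)) (count≤length (adj G w) L N⊆L)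

forced-neighbour : ∀ {n} (G : Graph n) w a b t → (∀ q → adj G w q ≡ true → q ∈ a ∷ b ∷ t ∷ []) →
  3 ≤ deg G w → adj G w t ≡ true
forced-neighbour G w a b t N⊆abt 3≤deg with adj G w t in wt
... | true  = refl
... | false = contradiction (deg≤length G w (a ∷ b ∷ []) N⊆ab) (<⇒≱ 3≤deg)
  where
  N⊆ab : ∀ q → adj G w q ≡ true → q ∈ a ∷ b ∷ []
  N⊆ab q wq with N⊆abt q wq
  ... | here q≡a                = here q≡a
  ... | there (here q≡b)        = there (here q≡b)
  ... | there (there (here refl)) with () ← trans (sym wq) wt

-- Deleting and inserting a vertex

deleteVertex : ∀ {m} → Fin (suc m) → Graph (suc m) → Graph m
deleteVertex v G = record
  { adj   = λ i j → adj G (punchIn v i) (punchIn v j)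
  ; sym   = λ i j → adj-sym G (punchIn v i) (punchIn v j)
  ; irref = λ i → irref G (punchIn v i)
  }

nbhd : ∀ {m} → Graph (suc m) → Fin (suc m) → Fin m → Bool
nbhd G v j = adj G v (punchIn v j)

deg≡count-nbhd : ∀ {m} (G : Graph (suc m)) v → deg G v ≡ count (nbhd G v)
deg≡count-nbhd G v = begin
  deg G v                                  ≡⟨ deg≡count G v ⟩
  count (adj G v)                          ≡⟨ sum-remove {i = v} (ind ∘ adj G v) ⟩
  ind (adj G v v) + count (nbhd G v)       ≡⟨ cong (λ b → ind b + count (nbhd G v)) (irref G v) ⟩
  count (nbhd G v)                         ∎
  where open ≡-Reasoning

deg-deleteVertex : ∀ {m} (G : Graph (suc m)) v w →
  deg (deleteVertex v G) w + ind (nbhd G v w) ≡ deg G (punchIn v w)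
deg-deleteVertex G v w = begin
  deg (deleteVertex v G) w + ind (nbhd G v w)      ≡⟨ cong₂ _+_ (deg≡count (deleteVertex v G) w) (cong ind (adj-sym G v u)) ⟩
  count (adj G u ∘ punchIn v) + ind (adj G u v)    ≡⟨ +-comm (count (adj G u ∘ punchIn v)) _ ⟩
  ind (adj G u v) + count (adj G u ∘ punchIn v)    ≡⟨ sum-remove {i = v} (ind ∘ adj G u) ⟨
  count (adj G u)                                  ≡⟨ deg≡count G u ⟨
  deg G u                                          ∎
  where
  open ≡-Reasoning
  u = punchIn v w

degSum-split : ∀ {m} (G : Graph (suc m)) v (K : Graph m) (g : Fin m → Bool) →
  (∀ w → deg K w + ind (g w) ≡ deg G (punchIn v w)) → degSum G ≡ deg G v + (degSum K + count g)
degSum-split {m} G v K g K+g≡G = begin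
  degSum G                                          ≡⟨ sum-remove {i = v} (deg G) ⟩
  deg G v + ∑[ w < m ] deg G (punchIn v w)          ≡⟨ cong (deg G v +_) (sum-cong-≗ (sym ∘ K+g≡G)) ⟩
  deg G v + ∑[ w < m ] (deg K w + ind (g w))        ≡⟨ cong (deg G v +_) (∑-distrib-+ (deg K) (ind ∘ g)) ⟩
  deg G v + (degSum K + count g)                    ∎
  where open ≡-Reasoning

degSum-deleteVertex : ∀ {m} (G : Graph (suc m)) v →
  degSum G ≡ degSum (deleteVertex v G) + 2 * deg G v
degSum-deleteVertex G v = begin
  degSum G                                    ≡⟨ degSum-split G v G′ (nbhd G v) (deg-deleteVertex G v) ⟩
  deg G v + (degSum G′ + count (nbhd G v))    ≡⟨ cong (λ d → deg G v + (degSum G′ + d)) (deg≡count-nbhd G v) ⟨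
  deg G v + (degSum G′ + deg G v)             ≡⟨ solve 2 (λ d s → d :+ (s :+ d) := s :+ con 2 :* d) refl (deg G v) (degSum G′) ⟩
  degSum G′ + 2 * deg G v                     ∎
  where
  open ≡-Reasoning
  G′ = deleteVertex v G

unpunch : ∀ {m} → Fin (suc m) → Fin (suc m) → Maybe (Fin m)
unpunch v i with v ≟ᶠ i
... | yes _   = nothing
... | no  v≢i = just (punchOut v≢i)

unpunch-≡ : ∀ {m} (v : Fin (suc m)) → unpunch v v ≡ nothing
unpunch-≡ v with v ≟ᶠ v
... | yes _   = refl
... | no  v≢v = contradiction refl v≢v

unpunch-punchIn : ∀ {m} (v : Fin (suc m)) j → unpunch v (punchIn v j) ≡ just j
unpunch-punchIn v j with v ≟ᶠ punchIn v j
... | yes v≡ = contradiction (sym v≡) (punchInᵢ≢i v j)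
... | no  _  = cong just (trans (punchOut-cong v refl) (punchOut-punchIn v))

≡⊎punchIn : ∀ {m} (v u : Fin (suc m)) → u ≡ v ⊎ ∃ λ w → u ≡ punchIn v w
≡⊎punchIn v u with v ≟ᶠ u
... | yes v≡u = inj₁ (sym v≡u)
... | no  v≢u = inj₂ (punchOut v≢u , sym (punchIn-punchOut v≢u))

insertVertex : ∀ {m} → Fin (suc m) → (Fin m → Bool) → Graph m → Graph (suc m)
insertVertex {m} v N G = record
  { adj   = λ i j → adj′ (unpunch v i) (unpunch v j)
  ; sym   = λ i j → adj′-sym (unpunch v i) (unpunch v j)
  ; irref = λ i → adj′-irref (unpunch v i)
  }
  where
  adj′ : Maybe (Fin m) → Maybe (Fin m) → Bool
  adj′ nothing  nothing  = false
  adj′ nothing  (just j) = N j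
  adj′ (just i) nothing  = N i
  adj′ (just i) (just j) = adj G i j
  adj′-sym : ∀ x y → adj′ x y ≡ adj′ y x
  adj′-sym nothing  nothing  = refl
  adj′-sym nothing  (just j) = refl
  adj′-sym (just i) nothing  = refl
  adj′-sym (just i) (just j) = adj-sym G i j
  adj′-irref : ∀ x → adj′ x x ≡ false
  adj′-irref nothing  = refl
  adj′-irref (just i) = irref G i

module _ {m} (v : Fin (suc m)) (N : Fin m → Bool) (G : Graph m) where

  private
    G⁺ = insertVertex v N G

  nbhd-insertVertex : ∀ j → nbhd G⁺ v j ≡ N j
  nbhd-insertVertex j rewrite unpunch-≡ v | unpunch-punchIn v j = refl

  adj-insertVertex : ∀ i j → adj G⁺ (punchIn v i) (punchIn v j) ≡ adj G i j
  adj-insertVertex i j rewrite unpunch-punchIn v i | unpunch-punchIn v j = refl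

  deg-deleteVertex-insertVertex : ∀ w → deg (deleteVertex v G⁺) w ≡ deg G w
  deg-deleteVertex-insertVertex w = begin
    deg (deleteVertex v G⁺) w                      ≡⟨ deg≡count (deleteVertex v G⁺) w ⟩
    count (λ j → adj G⁺ (punchIn v w) (punchIn v j)) ≡⟨ sum-cong-≗ (cong ind ∘ adj-insertVertex w) ⟩
    count (adj G w)                                ≡⟨ deg≡count G w ⟨
    deg G w                                        ∎
    where open ≡-Reasoning

  insertVertex-sameDegrees : (H : Graph (suc m)) → count N ≡ deg H v →
    (∀ w → deg G w + ind (N w) ≡ deg H (punchIn v w)) → SameDegrees G⁺ H
  insertVertex-sameDegrees H count-N deg-N u with ≡⊎punchIn v u
  ... | inj₁ refl = begin
    deg G⁺ v                 ≡⟨ deg≡count-nbhd G⁺ v ⟩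
    count (nbhd G⁺ v)        ≡⟨ sum-cong-≗ (cong ind ∘ nbhd-insertVertex) ⟩
    count N                  ≡⟨ count-N ⟩
    deg H v                  ∎
    where open ≡-Reasoning
  ... | inj₂ (w , refl) = begin
    deg G⁺ (punchIn v w)                                ≡⟨ deg-deleteVertex G⁺ v w ⟨
    deg (deleteVertex v G⁺) w + ind (nbhd G⁺ v w)       ≡⟨ cong₂ _+_ (deg-deleteVertex-insertVertex w)
                                                                     (cong ind (nbhd-insertVertex w)) ⟩
    deg G w + ind (N w)                                 ≡⟨ deg-N w ⟩
    deg H (punchIn v w)                                 ∎
    where open ≡-Reasoning

-- Editing edges

OnEdge : ∀ {n} → Fin n → Fin n → Fin n → Fin n → Set
OnEdge a b i j = (i ≡ a × j ≡ b) ⊎ (i ≡ b × j ≡ a)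

onEdge? : ∀ {n} (a b i j : Fin n) → Dec (OnEdge a b i j)
onEdge? a b i j = (i ≟ᶠ a ×-dec j ≟ᶠ b) ⊎-dec (i ≟ᶠ b ×-dec j ≟ᶠ a)

OnEdge-swap : ∀ {n} {a b i j : Fin n} → OnEdge a b i j → OnEdge a b j i
OnEdge-swap (inj₁ (i≡a , j≡b)) = inj₂ (j≡b , i≡a)
OnEdge-swap (inj₂ (i≡b , j≡a)) = inj₁ (j≡a , i≡b)

OnEdge-partner : ∀ {n} {a b i j k : Fin n} → a ≢ b → OnEdge a b i j → OnEdge a b i k → j ≡ k
OnEdge-partner a≢b (inj₁ (_ , refl))    (inj₁ (_ , refl))    = refl
OnEdge-partner a≢b (inj₁ (refl , _))    (inj₂ (refl , _))    = contradiction refl a≢b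
OnEdge-partner a≢b (inj₂ (refl , _))    (inj₁ (refl , _))    = contradiction refl a≢b
OnEdge-partner a≢b (inj₂ (_ , refl))    (inj₂ (_ , refl))    = refl

OnEdge-loop : ∀ {n} {a b i : Fin n} → OnEdge a b i i → a ≡ b
OnEdge-loop (inj₁ (refl , refl)) = refl
OnEdge-loop (inj₂ (refl , refl)) = refl

setEdge : ∀ {n} (a b : Fin n) → a ≢ b → Bool → Graph n → Graph n
setEdge {n} a b a≢b val G = record
  { adj   = adj′
  ; sym   = λ i j → cong₂ (if_then val else_)
              (does-⇔ (mk⇔ OnEdge-swap OnEdge-swap) (onEdge? a b i j) (onEdge? a b j i)) (adj-sym G i j)
  ; irref = λ i → cong₂ (if_then val else_)
              (dec-false (onEdge? a b i i) (a≢b ∘ OnEdge-loop)) (irref G i)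
  }
  where
  adj′ : Fin n → Fin n → Bool
  adj′ i j = if does (onEdge? a b i j) then val else adj G i j

removeEdge addEdge : ∀ {n} (a b : Fin n) → a ≢ b → Graph n → Graph n
removeEdge a b a≢b = setEdge a b a≢b false
addEdge    a b a≢b = setEdge a b a≢b true

module _ {n} {a b : Fin n} (a≢b : a ≢ b) (val : Bool) (G : Graph n) where

  private
    G′ = setEdge a b a≢b val G

  setEdge-on : ∀ {i j} → OnEdge a b i j → adj G′ i j ≡ val
  setEdge-on {i} {j} e = cong (if_then val else adj G i j) (dec-true (onEdge? a b i j) e)

  setEdge-off : ∀ {i j} → ¬ OnEdge a b i j → adj G′ i j ≡ adj G i j
  setEdge-off {i} {j} ¬e = cong (if_then val else adj G i j) (dec-false (onEdge? a b i j) ¬e)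

  deg-setEdge-off : ∀ {i} → i ≢ a → i ≢ b → deg G′ i ≡ deg G i
  deg-setEdge-off {i} i≢a i≢b = begin
    deg G′ i          ≡⟨ deg≡count G′ i ⟩
    count (adj G′ i)  ≡⟨ sum-cong-≗ (λ j → cong ind (setEdge-off (not-on j))) ⟩
    count (adj G i)   ≡⟨ deg≡count G i ⟨
    deg G i           ∎
    where
    open ≡-Reasoning
    not-on : ∀ j → ¬ OnEdge a b i j
    not-on j (inj₁ (i≡a , _)) = i≢a i≡a
    not-on j (inj₂ (i≡b , _)) = i≢b i≡b

  deg-setEdge-on : ∀ {i j} → OnEdge a b i j → deg G′ i + ind (adj G i j) ≡ deg G i + ind val
  deg-setEdge-on {i} {j} e = begin
    deg G′ i + ind (adj G i j)         ≡⟨ cong (_+ ind (adj G i j)) (deg≡count G′ i) ⟩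
    count (adj G′ i) + ind (adj G i j) ≡⟨ sum-agree-except j (λ k k≢j → cong ind (setEdge-off (k≢j ∘ partner))) ⟩
    count (adj G i) + ind (adj G′ i j) ≡⟨ cong₂ (λ d b → d + ind b) (sym (deg≡count G i)) (setEdge-on e) ⟩
    deg G i + ind val                  ∎
    where
    open ≡-Reasoning
    partner : ∀ {k} → OnEdge a b i k → k ≡ j
    partner e′ = OnEdge-partner a≢b e′ e

deg-removeEdge : ∀ {n} {a b : Fin n} (a≢b : a ≢ b) (G : Graph n) {i j} → OnEdge a b i j →
  adj G i j ≡ true → deg (removeEdge a b a≢b G) i + 1 ≡ deg G i
deg-removeEdge a≢b G {i} {j} e ij = begin
  deg (removeEdge _ _ a≢b G) i + 1               ≡⟨ cong (λ b → deg (removeEdge _ _ a≢b G) i + ind b) ij ⟨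
  deg (removeEdge _ _ a≢b G) i + ind (adj G i j) ≡⟨ deg-setEdge-on a≢b false G e ⟩
  deg G i + 0                                    ≡⟨ +-identityʳ (deg G i) ⟩
  deg G i                                        ∎
  where open ≡-Reasoning

deg-addEdge : ∀ {n} {a b : Fin n} (a≢b : a ≢ b) (G : Graph n) {i j} → OnEdge a b i j →
  adj G i j ≡ false → deg (addEdge a b a≢b G) i ≡ deg G i + 1
deg-addEdge a≢b G {i} {j} e ¬ij = begin
  deg (addEdge _ _ a≢b G) i                      ≡⟨ +-identityʳ _ ⟨
  deg (addEdge _ _ a≢b G) i + 0                  ≡⟨ cong (λ b → deg (addEdge _ _ a≢b G) i + ind b) ¬ij ⟨
  deg (addEdge _ _ a≢b G) i + ind (adj G i j)    ≡⟨ deg-setEdge-on a≢b true G e ⟩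
  deg G i + 1                                    ∎
  where open ≡-Reasoning

addEdge-⊇ : ∀ {n} {a b : Fin n} (a≢b : a ≢ b) (G : Graph n) {i j} → adj G i j ≡ true → adj (addEdge a b a≢b G) i j ≡ true
addEdge-⊇ {a = a} {b} a≢b G {i} {j} ij with does (onEdge? a b i j)
... | true  = refl
... | false = ij

¬OnEdgeˡ : ∀ {n} {a b u u′ : Fin n} → u ≢ a → u ≢ b → ¬ OnEdge a b u u′
¬OnEdgeˡ u≢a _ (inj₁ (u≡a , _)) = u≢a u≡a
¬OnEdgeˡ _ u≢b (inj₂ (u≡b , _)) = u≢b u≡b

¬OnEdgeʳ : ∀ {n} {a b u u′ : Fin n} → u′ ≢ a → u′ ≢ b → ¬ OnEdge a b u u′
¬OnEdgeʳ _ u′≢b (inj₁ (_ , u′≡b)) = u′≢b u′≡b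
¬OnEdgeʳ u′≢a _ (inj₂ (_ , u′≡a)) = u′≢a u′≡a

¬OnEdge-apart : ∀ {n} {a b u u′ : Fin n} → a ≢ u → a ≢ u′ → ¬ OnEdge a b u u′
¬OnEdge-apart a≢u _ (inj₁ (u≡a , _)) = a≢u (sym u≡a)
¬OnEdge-apart _ a≢u′ (inj₂ (_ , u′≡a)) = a≢u′ (sym u′≡a)

memberOf-∷-≢ : ∀ {n} {a w : Fin n} (L : List (Fin n)) → w ≢ a → memberOf (a ∷ L) w ≡ memberOf L w
memberOf-∷-≢ {a = a} {w} L w≢a = does-⇔ (mk⇔ drop there) (w ∈? (a ∷ L)) (w ∈? L)
  where
  drop : w ∈ a ∷ L → w ∈ L
  drop (here w≡a)  = contradiction w≡a w≢a
  drop (there w∈L) = w∈L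

deg-removeEdge-memberOf : ∀ {n} (H : Graph n) {a b} (ab : adj H a b ≡ true) {L : List (Fin n)} → a ∉ L → b ∉ L →
  ∀ w → deg (removeEdge a b (edge⇒≢ H ab) H) w + ind (memberOf (a ∷ b ∷ L) w) ≡ deg H w + ind (memberOf L w)
deg-removeEdge-memberOf H {a} {b} ab {L} a∉L b∉L w with toSum (w ≟ᶠ a) | toSum (w ≟ᶠ b)
... | inj₁ refl | _ = begin
  deg H′ a + ind (memberOf (a ∷ b ∷ L) a)  ≡⟨ cong (λ t → deg H′ a + ind t) (memberOf-∈ (a ∷ b ∷ L) (here refl)) ⟩
  deg H′ a + 1                             ≡⟨ deg-removeEdge (edge⇒≢ H ab) H (inj₁ (refl , refl)) ab ⟩
  deg H a                                  ≡⟨ +-identityʳ _ ⟨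
  deg H a + 0                              ≡⟨ cong (λ t → deg H a + ind t) (memberOf-∉ L a∉L) ⟨
  deg H a + ind (memberOf L a)             ∎
  where
  open ≡-Reasoning
  H′ = removeEdge a b (edge⇒≢ H ab) H
... | inj₂ _ | inj₁ refl = begin
  deg H′ b + ind (memberOf (a ∷ b ∷ L) b)  ≡⟨ cong (λ t → deg H′ b + ind t) (memberOf-∈ (a ∷ b ∷ L) (there (here refl))) ⟩
  deg H′ b + 1                             ≡⟨ deg-removeEdge (edge⇒≢ H ab) H (inj₂ (refl , refl)) (edge-sym H ab) ⟩
  deg H b                                  ≡⟨ +-identityʳ _ ⟨
  deg H b + 0                              ≡⟨ cong (λ t → deg H b + ind t) (memberOf-∉ L b∉L) ⟨
  deg H b + ind (memberOf L b)             ∎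
  where
  open ≡-Reasoning
  H′ = removeEdge a b (edge⇒≢ H ab) H
... | inj₂ w≢a | inj₂ w≢b = cong₂ (λ d t → d + ind t) (deg-setEdge-off (edge⇒≢ H ab) false H w≢a w≢b)
  (trans (memberOf-∷-≢ (b ∷ L) w≢a) (memberOf-∷-≢ L w≢b))

switch : ∀ {n} (a b c d : Fin n) → a ≢ b → c ≢ d → a ≢ c → b ≢ d → Graph n → Graph n
switch a b c d a≢b c≢d a≢c b≢d G =
  addEdge b d b≢d (addEdge a c a≢c (removeEdge c d c≢d (removeEdge a b a≢b G)))

module _ {n} (G : Graph n) {a b c d : Fin n}
  (a≢b : a ≢ b) (a≢c : a ≢ c) (a≢d : a ≢ d) (b≢c : b ≢ c) (b≢d : b ≢ d) (c≢d : c ≢ d)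
  (ab : adj G a b ≡ true) (cd : adj G c d ≡ true) (ac : adj G a c ≡ false) (bd : adj G b d ≡ false) where

  private
    G₁ = removeEdge a b a≢b G
    G₂ = removeEdge c d c≢d G₁
    G₃ = addEdge a c a≢c G₂
    G₄ = addEdge b d b≢d G₃
    off₁ = setEdge-off a≢b false G
    off₂ = setEdge-off c≢d false G₁
    off₃ = setEdge-off a≢c true G₂
    open ≡-Reasoning

  switch-sameDegrees : SameDegrees (switch a b c d a≢b c≢d a≢c b≢d G) G
  switch-sameDegrees i with toSum (i ≟ᶠ a) | toSum (i ≟ᶠ b) | toSum (i ≟ᶠ c) | toSum (i ≟ᶠ d)
  ... | inj₁ refl | _ | _ | _ = begin
    deg G₄ a       ≡⟨ deg-setEdge-off b≢d true G₃ a≢b a≢d ⟩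
    deg G₃ a       ≡⟨ deg-addEdge a≢c G₂ (inj₁ (refl , refl)) G₂ac ⟩
    deg G₂ a + 1   ≡⟨ cong (_+ 1) (deg-setEdge-off c≢d false G₁ a≢c a≢d) ⟩
    deg G₁ a + 1   ≡⟨ deg-removeEdge a≢b G (inj₁ (refl , refl)) ab ⟩
    deg G a        ∎
    where
    G₂ac = trans (off₂ (¬OnEdgeˡ a≢c a≢d)) (trans (off₁ (¬OnEdgeʳ (≢-sym a≢c) (≢-sym b≢c))) ac)
  ... | inj₂ _ | inj₁ refl | _ | _ = begin
    deg G₄ b       ≡⟨ deg-addEdge b≢d G₃ (inj₁ (refl , refl)) G₃bd ⟩
    deg G₃ b + 1   ≡⟨ cong (_+ 1) (deg-setEdge-off a≢c true G₂ (≢-sym a≢b) b≢c) ⟩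
    deg G₂ b + 1   ≡⟨ cong (_+ 1) (deg-setEdge-off c≢d false G₁ b≢c b≢d) ⟩
    deg G₁ b + 1   ≡⟨ deg-removeEdge a≢b G (inj₂ (refl , refl)) (edge-sym G ab) ⟩
    deg G b        ∎
    where
    G₃bd = trans (off₃ (¬OnEdgeˡ (≢-sym a≢b) b≢c)) (trans (off₂ (¬OnEdgeˡ b≢c b≢d))
             (trans (off₁ (¬OnEdgeʳ (≢-sym a≢d) (≢-sym b≢d))) bd))
  ... | inj₂ _ | inj₂ _ | inj₁ refl | _ = begin
    deg G₄ c       ≡⟨ deg-setEdge-off b≢d true G₃ (≢-sym b≢c) c≢d ⟩
    deg G₃ c       ≡⟨ deg-addEdge a≢c G₂ (inj₂ (refl , refl)) G₂ca ⟩
    deg G₂ c + 1   ≡⟨ deg-removeEdge c≢d G₁ (inj₁ (refl , refl)) G₁cd ⟩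
    deg G₁ c       ≡⟨ deg-setEdge-off a≢b false G (≢-sym a≢c) (≢-sym b≢c) ⟩
    deg G c        ∎
    where
    G₂ca = trans (off₂ (¬OnEdgeʳ a≢c a≢d)) (trans (off₁ (¬OnEdgeˡ (≢-sym a≢c) (≢-sym b≢c)))
             (trans (adj-sym G c a) ac))
    G₁cd = trans (off₁ (¬OnEdgeˡ (≢-sym a≢c) (≢-sym b≢c))) cd
  ... | inj₂ _ | inj₂ _ | inj₂ _ | inj₁ refl = begin
    deg G₄ d       ≡⟨ deg-addEdge b≢d G₃ (inj₂ (refl , refl)) G₃db ⟩
    deg G₃ d + 1   ≡⟨ cong (_+ 1) (deg-setEdge-off a≢c true G₂ (≢-sym a≢d) (≢-sym c≢d)) ⟩
    deg G₂ d + 1   ≡⟨ deg-removeEdge c≢d G₁ (inj₂ (refl , refl)) G₁dc ⟩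
    deg G₁ d       ≡⟨ deg-setEdge-off a≢b false G (≢-sym a≢d) (≢-sym b≢d) ⟩
    deg G d        ∎
    where
    G₃db = trans (off₃ (¬OnEdgeˡ (≢-sym a≢d) (≢-sym c≢d))) (trans (off₂ (¬OnEdgeʳ b≢c b≢d))
             (trans (off₁ (¬OnEdgeˡ (≢-sym a≢d) (≢-sym b≢d))) (trans (adj-sym G d b) bd)))
    G₁dc = trans (off₁ (¬OnEdgeˡ (≢-sym a≢d) (≢-sym b≢d))) (edge-sym G cd)
  ... | inj₂ i≢a | inj₂ i≢b | inj₂ i≢c | inj₂ i≢d = begin
    deg G₄ i       ≡⟨ deg-setEdge-off b≢d true G₃ i≢b i≢d ⟩
    deg G₃ i       ≡⟨ deg-setEdge-off a≢c true G₂ i≢a i≢c ⟩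
    deg G₂ i       ≡⟨ deg-setEdge-off c≢d false G₁ i≢c i≢d ⟩
    deg G₁ i       ≡⟨ deg-setEdge-off a≢b false G i≢a i≢b ⟩
    deg G i        ∎

module _ {n} (G : Graph n) {a b c d : Fin n} (a≢b : a ≢ b) (c≢d : c ≢ d) (a≢c : a ≢ c) (b≢d : b ≢ d) where

  private
    G₁ = removeEdge a b a≢b G
    G₂ = removeEdge c d c≢d G₁
    G₃ = addEdge a c a≢c G₂

  switch-⊇ : ∀ {i j} → adj G i j ≡ true → ¬ OnEdge a b i j → ¬ OnEdge c d i j →
    adj (switch a b c d a≢b c≢d a≢c b≢d G) i j ≡ true
  switch-⊇ {i} {j} ij ¬ab ¬cd = addEdge-⊇ b≢d G₃ {i} {j} (addEdge-⊇ a≢c G₂ {i} {j}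
    (trans (setEdge-off c≢d false G₁ ¬cd) (trans (setEdge-off a≢b false G ¬ab) ij)))

  switch-ac : adj (switch a b c d a≢b c≢d a≢c b≢d G) a c ≡ true
  switch-ac = addEdge-⊇ b≢d G₃ {a} {c} (setEdge-on a≢c true G₂ (inj₁ (refl , refl)))

-- Copies of K5 − Y4

-- K5 − Y4 is the diamond s₁ s₂ c x (all edges but cx) with the pendant edge xp;
-- as vertices of K5-Y4, p s₁ s₂ c x are 0 1 2 3 4.
record Copy {n} (G : Graph n) : Set where
  constructor mkCopy
  field
    p x s₁ s₂ c : Fin n
    p≢x  : p ≢ x
    p≢s₁ : p ≢ s₁
    p≢s₂ : p ≢ s₂
    p≢c  : p ≢ c
    x≢s₁ : x ≢ s₁
    x≢s₂ : x ≢ s₂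
    x≢c  : x ≢ c
    s₁≢s₂ : s₁ ≢ s₂
    s₁≢c : s₁ ≢ c
    s₂≢c : s₂ ≢ c
    s₁s₂ : adj G s₁ s₂ ≡ true
    s₁c  : adj G s₁ c ≡ true
    s₁x  : adj G s₁ x ≡ true
    s₂c  : adj G s₂ c ≡ true
    s₂x  : adj G s₂ x ≡ true
    xp   : adj G x p ≡ true

copy⇒subgraph : ∀ {n} {G : Graph n} → Copy G → SubgraphOf K5-Y4 G
copy⇒subgraph {n} {G} C = f , injective , edges
  where
  open Copy C
  f : Fin 5 → Fin n
  f 0F = p
  f 1F = s₁
  f 2F = s₂
  f 3F = c
  f 4F = x
  injective : ∀ {u w} → f u ≡ f w → u ≡ w
  injective {0F} {0F} _ = refl
  injective {0F} {1F} e = contradiction e p≢s₁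
  injective {0F} {2F} e = contradiction e p≢s₂
  injective {0F} {3F} e = contradiction e p≢c
  injective {0F} {4F} e = contradiction e p≢x
  injective {1F} {0F} e = contradiction (sym e) p≢s₁
  injective {1F} {1F} _ = refl
  injective {1F} {2F} e = contradiction e s₁≢s₂
  injective {1F} {3F} e = contradiction e s₁≢c
  injective {1F} {4F} e = contradiction (sym e) x≢s₁
  injective {2F} {0F} e = contradiction (sym e) p≢s₂
  injective {2F} {1F} e = contradiction (sym e) s₁≢s₂
  injective {2F} {2F} _ = refl
  injective {2F} {3F} e = contradiction e s₂≢c
  injective {2F} {4F} e = contradiction (sym e) x≢s₂
  injective {3F} {0F} e = contradiction (sym e) p≢c
  injective {3F} {1F} e = contradiction (sym e) s₁≢c
  injective {3F} {2F} e = contradiction (sym e) s₂≢c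
  injective {3F} {3F} _ = refl
  injective {3F} {4F} e = contradiction (sym e) x≢c
  injective {4F} {0F} e = contradiction (sym e) p≢x
  injective {4F} {1F} e = contradiction e x≢s₁
  injective {4F} {2F} e = contradiction e x≢s₂
  injective {4F} {3F} e = contradiction e x≢c
  injective {4F} {4F} _ = refl
  edges : ∀ u w → adj K5-Y4 u w ≡ true → adj G (f u) (f w) ≡ true
  edges 0F 4F _ = edge-sym G xp
  edges 4F 0F _ = xp
  edges 1F 2F _ = s₁s₂
  edges 2F 1F _ = edge-sym G s₁s₂
  edges 1F 3F _ = s₁c
  edges 3F 1F _ = edge-sym G s₁c
  edges 1F 4F _ = s₁x
  edges 4F 1F _ = edge-sym G s₁x
  edges 2F 3F _ = s₂c
  edges 3F 2F _ = edge-sym G s₂c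
  edges 2F 4F _ = s₂x
  edges 4F 2F _ = edge-sym G s₂x
  edges 0F 0F ()
  edges 0F 1F ()
  edges 0F 2F ()
  edges 0F 3F ()
  edges 1F 0F ()
  edges 1F 1F ()
  edges 2F 0F ()
  edges 2F 2F ()
  edges 3F 0F ()
  edges 3F 3F ()
  edges 3F 4F ()
  edges 4F 3F ()
  edges 4F 4F ()

swap-s₁s₂ : ∀ {n} {G : Graph n} → Copy G → Copy G
swap-s₁s₂ {G = G} (mkCopy p x s₁ s₂ c p≢x p≢s₁ p≢s₂ p≢c x≢s₁ x≢s₂ x≢c s₁≢s₂ s₁≢c s₂≢c s₁s₂ s₁c s₁x s₂c s₂x xp) =
  mkCopy p x s₂ s₁ c p≢x p≢s₂ p≢s₁ p≢c x≢s₂ x≢s₁ x≢c (≢-sym s₁≢s₂) s₂≢c s₁≢c (edge-sym G s₁s₂) s₂c s₂x s₁c s₁x xp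

copy-removeEdge : ∀ {n} {G : Graph n} (C : Copy G) {a b} (a≢b : a ≢ b) → let open Copy C in
  ¬ OnEdge a b s₁ s₂ → ¬ OnEdge a b s₁ c → ¬ OnEdge a b s₁ x →
  ¬ OnEdge a b s₂ c → ¬ OnEdge a b s₂ x → ¬ OnEdge a b x p → Copy (removeEdge a b a≢b G)
copy-removeEdge {G = G} (mkCopy p x s₁ s₂ c p≢x p≢s₁ p≢s₂ p≢c x≢s₁ x≢s₂ x≢c s₁≢s₂ s₁≢c s₂≢c s₁s₂ s₁c s₁x s₂c s₂x xp)
  a≢b ¬s₁s₂ ¬s₁c ¬s₁x ¬s₂c ¬s₂x ¬xp =
  mkCopy p x s₁ s₂ c p≢x p≢s₁ p≢s₂ p≢c x≢s₁ x≢s₂ x≢c s₁≢s₂ s₁≢c s₂≢c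
    (keep ¬s₁s₂ s₁s₂) (keep ¬s₁c s₁c) (keep ¬s₁x s₁x) (keep ¬s₂c s₂c) (keep ¬s₂x s₂x) (keep ¬xp xp)
  where
  keep : ∀ {u u′} → ¬ OnEdge _ _ u u′ → adj G u u′ ≡ true → adj (removeEdge _ _ a≢b G) u u′ ≡ true
  keep ¬e e = trans (setEdge-off a≢b false G ¬e) e

copy-insertVertex : ∀ {m} (v : Fin (suc m)) N {G : Graph m} → Copy G → Copy (insertVertex v N G)
copy-insertVertex v N {G} (mkCopy p x s₁ s₂ c p≢x p≢s₁ p≢s₂ p≢c x≢s₁ x≢s₂ x≢c s₁≢s₂ s₁≢c s₂≢c s₁s₂ s₁c s₁x s₂c s₂x xp) =
  mkCopy (↑ p) (↑ x) (↑ s₁) (↑ s₂) (↑ c)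
    (↑≢ p≢x) (↑≢ p≢s₁) (↑≢ p≢s₂) (↑≢ p≢c) (↑≢ x≢s₁) (↑≢ x≢s₂) (↑≢ x≢c) (↑≢ s₁≢s₂) (↑≢ s₁≢c) (↑≢ s₂≢c)
    (↑e s₁s₂) (↑e s₁c) (↑e s₁x) (↑e s₂c) (↑e s₂x) (↑e xp)
  where
  ↑ = punchIn v
  ↑≢ : ∀ {i j} → i ≢ j → ↑ i ≢ ↑ j
  ↑≢ {i} {j} i≢j = i≢j ∘ punchIn-injective v i j
  ↑e : ∀ {i j} → adj G i j ≡ true → adj (insertVertex v N G) (↑ i) (↑ j) ≡ true
  ↑e {i} {j} = trans (adj-insertVertex v N G i j)

copy-transport : ∀ {n} {G H : Graph n} → (∀ i j → adj G i j ≡ adj H i j) → Copy G → Copy H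
copy-transport {G = G} {H} G≗H (mkCopy p x s₁ s₂ c p≢x p≢s₁ p≢s₂ p≢c x≢s₁ x≢s₂ x≢c s₁≢s₂ s₁≢c s₂≢c s₁s₂ s₁c s₁x s₂c s₂x xp) =
  mkCopy p x s₁ s₂ c p≢x p≢s₁ p≢s₂ p≢c x≢s₁ x≢s₂ x≢c s₁≢s₂ s₁≢c s₂≢c
    (move s₁s₂) (move s₁c) (move s₁x) (move s₂c) (move s₂x) (move xp)
  where
  move : ∀ {i j} → adj G i j ≡ true → adj H i j ≡ true
  move {i} {j} e = trans (sym (G≗H i j)) e

-- Spare edges

SpareEdge : ∀ {m} → Graph m → Fin m → Set
SpareEdge {m} K z = Σ (Fin m) λ a → Σ (Fin m) λ b → a ≢ z × b ≢ z ×
  Σ (adj K a b ≡ true) λ ab → Copy (removeEdge a b (edge⇒≢ K ab) K)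

module _ {m} {K : Graph m} {z : Fin m} (C : Copy K) where
  open Copy C

  spare-outside : ∀ {w} → w ≢ z → w ≢ p → w ≢ x → w ≢ s₁ → w ≢ s₂ → w ≢ c → 2 ≤ deg K w → SpareEdge K z
  spare-outside {w} w≢z w≢p w≢x w≢s₁ w≢s₂ w≢c 2≤deg with neighbour-outside K w (z ∷ []) 2≤deg
  ... | q , wq , q∉z = w , q , w≢z , q∉z ∘ here , wq ,
    copy-removeEdge C (edge⇒≢ K wq) (¬OnEdge-apart w≢s₁ w≢s₂) (¬OnEdge-apart w≢s₁ w≢c) (¬OnEdge-apart w≢s₁ w≢x)
      (¬OnEdge-apart w≢s₂ w≢c) (¬OnEdge-apart w≢s₂ w≢x) (¬OnEdge-apart w≢x w≢p)

  spare-at-p : p ≢ z → 3 ≤ deg K p → SpareEdge K z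
  spare-at-p p≢z 3≤deg with neighbour-outside K p (x ∷ z ∷ []) 3≤deg
  ... | q , pq , q∉xz = p , q , p≢z , q∉xz ∘ there ∘ here , pq ,
    copy-removeEdge C (edge⇒≢ K pq) (¬OnEdge-apart p≢s₁ p≢s₂) (¬OnEdge-apart p≢s₁ p≢c) (¬OnEdge-apart p≢s₁ p≢x)
      (¬OnEdge-apart p≢s₂ p≢c) (¬OnEdge-apart p≢s₂ p≢x) (¬OnEdgeˡ (≢-sym p≢x) (q∉xz ∘ here ∘ sym))

  spare-at-c : ∀ {q} → c ≢ z → adj K c q ≡ true → q ∉ s₁ ∷ s₂ ∷ [] → q ≢ z → SpareEdge K z
  spare-at-c {q} c≢z cq q∉ q≢z = c , q , c≢z , q≢z , cq ,
    copy-removeEdge C (edge⇒≢ K cq) (¬OnEdge-apart (≢-sym s₁≢c) (≢-sym s₂≢c)) (¬OnEdgeˡ s₁≢c (q∉ ∘ here ∘ sym))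
      (¬OnEdge-apart (≢-sym s₁≢c) (≢-sym x≢c)) (¬OnEdgeˡ s₂≢c (q∉ ∘ there ∘ here ∘ sym))
      (¬OnEdge-apart (≢-sym s₂≢c) (≢-sym x≢c)) (¬OnEdge-apart (≢-sym x≢c) (≢-sym p≢c))

  spare-at-x : ∀ {q} → x ≢ z → adj K x q ≡ true → q ∉ s₁ ∷ s₂ ∷ p ∷ [] → q ≢ z → SpareEdge K z
  spare-at-x {q} x≢z xq q∉ q≢z = x , q , x≢z , q≢z , xq ,
    copy-removeEdge C (edge⇒≢ K xq) (¬OnEdge-apart x≢s₁ x≢s₂) (¬OnEdge-apart x≢s₁ x≢c)
      (¬OnEdgeˡ (≢-sym x≢s₁) (q∉ ∘ here ∘ sym)) (¬OnEdge-apart x≢s₂ x≢c)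
      (¬OnEdgeˡ (≢-sym x≢s₂) (q∉ ∘ there ∘ here ∘ sym)) (¬OnEdgeʳ p≢x (q∉ ∘ there ∘ there ∘ here ∘ sym))

  spare-at-s₁ : ∀ {q} → s₁ ≢ z → adj K s₁ q ≡ true → q ∉ s₂ ∷ c ∷ x ∷ [] → q ≢ z → SpareEdge K z
  spare-at-s₁ {q} s₁≢z s₁q q∉ q≢z = s₁ , q , s₁≢z , q≢z , s₁q ,
    copy-removeEdge C (edge⇒≢ K s₁q) (¬OnEdgeʳ (≢-sym s₁≢s₂) (q∉ ∘ here ∘ sym))
      (¬OnEdgeʳ (≢-sym s₁≢c) (q∉ ∘ there ∘ here ∘ sym)) (¬OnEdgeʳ x≢s₁ (q∉ ∘ there ∘ there ∘ here ∘ sym))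
      (¬OnEdge-apart s₁≢s₂ s₁≢c) (¬OnEdge-apart s₁≢s₂ (≢-sym x≢s₁)) (¬OnEdge-apart (≢-sym x≢s₁) (≢-sym p≢s₁))

  -- p s₁ x c span a diamond missing xc, and c s₂ is a pendant edge at c.
  spare-s₁s₂ : s₁ ≢ z → s₂ ≢ z → adj K s₁ p ≡ true → adj K c p ≡ true → SpareEdge K z
  spare-s₁s₂ s₁≢z s₂≢z s₁p cp = s₁ , s₂ , s₁≢z , s₂≢z , s₁s₂ ,
    mkCopy s₂ c p s₁ x s₂≢c (≢-sym p≢s₂) (≢-sym s₁≢s₂) (≢-sym x≢s₂) (≢-sym p≢c) (≢-sym s₁≢c) (≢-sym x≢c) p≢s₁ p≢x (≢-sym x≢s₁)
      (keep (¬OnEdgeˡ p≢s₁ p≢s₂) (edge-sym K s₁p)) (keep (¬OnEdgeˡ p≢s₁ p≢s₂) (edge-sym K xp))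
      (keep (¬OnEdgeˡ p≢s₁ p≢s₂) (edge-sym K cp)) (keep (¬OnEdgeʳ x≢s₁ x≢s₂) s₁x)
      (keep (¬OnEdgeʳ (≢-sym s₁≢c) (≢-sym s₂≢c)) s₁c) (keep (¬OnEdgeˡ (≢-sym s₁≢c) (≢-sym s₂≢c)) (edge-sym K s₂c))
    where
    keep : ∀ {u u′} → ¬ OnEdge s₁ s₂ u u′ → adj K u u′ ≡ true → adj (removeEdge s₁ s₂ (edge⇒≢ K s₁s₂) K) u u′ ≡ true
    keep ¬e e = trans (setEdge-off (edge⇒≢ K s₁s₂) false K ¬e) e

module _ {m} {K : Graph m} (C : Copy K)
  (3≤deg : ∀ w → w ≢ Copy.p C → 3 ≤ deg K w)
  (Nc⊆ : ∀ q → adj K (Copy.c C) q ≡ true → q ∈ Copy.s₁ C ∷ Copy.s₂ C ∷ Copy.p C ∷ [])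
  (Nx⊆ : ∀ q → adj K (Copy.x C) q ≡ true → q ∈ Copy.s₁ C ∷ Copy.s₂ C ∷ Copy.p C ∷ [])
  (s₁p : adj K (Copy.s₁ C) (Copy.p C) ≡ false) (s₂p : adj K (Copy.s₂ C) (Copy.p C) ≡ false) where
  open Copy C

  spare-at-high-degree : ∀ w → 4 ≤ deg K w → SpareEdge K p
  spare-at-high-degree w 4≤deg with w ≟ᶠ p
  ... | yes refl with neighbour-outside K p (x ∷ c ∷ []) (≤-trans (n≤1+n 3) 4≤deg)
  ...   | q , pq , q∉xc = spare-outside C q≢p q≢p (q∉xc ∘ here) q≢s₁ q≢s₂ (q∉xc ∘ there ∘ here)
                            (≤-trans (n≤1+n 2) (3≤deg q q≢p))
    where
    q≢p = ≢-sym (edge⇒≢ K pq)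
    q≢s₁ = non-neighbour-≢ K (trans (adj-sym K p s₁) s₁p) pq
    q≢s₂ = non-neighbour-≢ K (trans (adj-sym K p s₂) s₂p) pq
  spare-at-high-degree w 4≤deg | no w≢p with w ≟ᶠ x
  ... | yes refl = contradiction (deg≤length K x _ Nx⊆) (<⇒≱ 4≤deg)
  ... | no w≢x with w ≟ᶠ c
  ... | yes refl = contradiction (deg≤length K c _ Nc⊆) (<⇒≱ 4≤deg)
  ... | no w≢c with w ≟ᶠ s₁
  ... | yes refl with neighbour-outside K s₁ (s₂ ∷ c ∷ x ∷ []) 4≤deg
  ...   | q , s₁q , q∉ = spare-at-s₁ C w≢p s₁q q∉ (non-neighbour-≢ K s₁p s₁q)
  spare-at-high-degree w 4≤deg | no w≢p | no w≢x | no w≢c | no w≢s₁ with w ≟ᶠ s₂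
  ... | yes refl with neighbour-outside K s₂ (s₁ ∷ c ∷ x ∷ []) 4≤deg
  ...   | q , s₂q , q∉ = spare-at-s₁ (swap-s₁s₂ C) w≢p s₂q q∉ (non-neighbour-≢ K s₂p s₂q)
  spare-at-high-degree w 4≤deg | no w≢p | no w≢x | no w≢c | no w≢s₁ | no w≢s₂ =
    spare-outside C w≢p w≢p w≢x w≢s₁ w≢s₂ w≢c (≤-trans (n≤1+n 2) (3≤deg w w≢p))

spare-edge : ∀ {m} {K : Graph m} {z} → 5 ≤ m → Copy K → (∀ w → w ≢ z → 3 ≤ deg K w) →
  4 * m ≤ degSum K + 4 → SpareEdge K z
spare-edge {m} {K} {z} 5≤m C 3≤deg large with Copy.p C ≟ᶠ z
... | no p≢z   = spare-at-p C p≢z (3≤deg _ p≢z)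
... | yes refl = at-pendant
  where
  open Copy C
  m≤4 : (∀ w → deg K w ≤ 3) → m ≤ 4
  m≤4 deg≤3 = +-cancelˡ-≤ (m * 3) m 4 (begin
    m * 3 + m      ≡⟨ solve 1 (λ m → m :* con 3 :+ m := con 4 :* m) refl m ⟩
    4 * m          ≤⟨ large ⟩
    degSum K + 4   ≤⟨ +-monoˡ-≤ 4 (degSum≤ K deg≤3) ⟩
    m * 3 + 4      ∎)
    where open ≤-Reasoning
  -- Here z = p.  Unless c or x has a neighbour outside s₁ s₂ p, or p is adjacent to s₁ or s₂,
  -- a vertex of degree ≥ 4 carries a spare edge, and one exists because 3m < 4m − 4.
  at-pendant : SpareEdge K p
  at-pendant with outside? (adj K c) (s₁ ∷ s₂ ∷ p ∷ [])
  ... | inj₁ (q , cq , q∉) = spare-at-c C (≢-sym p≢c) cq (q∉ ∘ ∈-++⁺ˡ) (q∉ ∘ there ∘ there ∘ here)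
  ... | inj₂ Nc⊆ with outside? (adj K x) (s₁ ∷ s₂ ∷ p ∷ [])
  ...   | inj₁ (q , xq , q∉) = spare-at-x C (≢-sym p≢x) xq q∉ (q∉ ∘ there ∘ there ∘ here)
  ...   | inj₂ Nx⊆ with forced-neighbour K c s₁ s₂ p Nc⊆ (3≤deg c (≢-sym p≢c)) | adj K s₁ p in s₁p | adj K s₂ p in s₂p
  ...     | cp | true  | _    = spare-s₁s₂ C (≢-sym p≢s₁) (≢-sym p≢s₂) s₁p cp
  ...     | cp | false | true = spare-s₁s₂ (swap-s₁s₂ C) (≢-sym p≢s₂) (≢-sym p≢s₁) s₂p cp
  ...     | _  | false | false with all? (λ w → deg K w ≤? 3)
  ...       | yes deg≤3 = contradiction (m≤4 deg≤3) (<⇒≱ 5≤m)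
  ...       | no ¬deg≤3 with ¬∀⟶∃¬ m _ (λ w → deg K w ≤? 3) ¬deg≤3
  ...         | w , deg≰3 = spare-at-high-degree C 3≤deg Nc⊆ Nx⊆ s₁p s₂p w (≰⇒> deg≰3)

-- The induction step

CopyRealization : ∀ {n} → Graph n → Set
CopyRealization {n} G = Σ (Graph n) λ H → SameDegrees H G × Copy H

Rearrangeable : ℕ → Set
Rearrangeable n = (G : Graph n) → 4 * n ≤ degSum G + 4 → CopyRealization G

realization-by-deletion : ∀ {m} → Rearrangeable m → (G : Graph (suc m)) (v : Fin (suc m)) →
  4 * m ≤ degSum (deleteVertex v G) + 4 → CopyRealization G
realization-by-deletion IH G v large with IH (deleteVertex v G) large
... | H , H≈G∖v , C = insertVertex v (nbhd G v) H ,
  insertVertex-sameDegrees v (nbhd G v) H G (sym (deg≡count-nbhd G v))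
    (λ w → trans (cong (_+ _) (H≈G∖v w)) (deg-deleteVertex G v w)) ,
  copy-insertVertex v (nbhd G v) C

record Residual {m} (K : Graph m) (z : Fin m) (G : Graph (suc m)) (v : Fin (suc m)) : Set where
  constructor residual
  field
    deg-residual : ∀ w → deg K w + ind (memberOf (z ∷ []) w) ≡ deg G (punchIn v w)
open Residual

module _ {m} {K : Graph m} {z} {G : Graph (suc m)} {v} (res : Residual K z G v) where

  degSum-residual : degSum G ≡ deg G v + (degSum K + 1)
  degSum-residual = trans (degSum-split G v K (memberOf (z ∷ [])) (deg-residual res))
    (cong (λ k → deg G v + (degSum K + k)) (count-memberOf {L = z ∷ []} ([] ∷ [])))

  residual-large : deg G v ≡ 3 → 4 * suc m ≤ degSum G + 4 → 4 * m ≤ degSum K + 4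
  residual-large deg≡3 large = +-cancelˡ-≤ 4 (4 * m) (degSum K + 4) (begin
    4 + 4 * m                       ≡⟨ *-suc 4 m ⟨
    4 * suc m                       ≤⟨ large ⟩
    degSum G + 4                    ≡⟨ cong (_+ 4) degSum-residual ⟩
    deg G v + (degSum K + 1) + 4    ≡⟨ cong (λ d → d + (degSum K + 1) + 4) deg≡3 ⟩
    3 + (degSum K + 1) + 4          ≡⟨ solve 1 (λ s → con 3 :+ (s :+ con 1) :+ con 4 := con 4 :+ (s :+ con 4))
                                               refl (degSum K) ⟩
    4 + (degSum K + 4)              ∎)
    where open ≤-Reasoning

  residual-sameDegrees : ∀ {H} → SameDegrees H K → Residual H z G v
  residual-sameDegrees H≈K = residual λ w → trans (cong (_+ _) (H≈K w)) (deg-residual res w)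

  residual-≢ : ∀ {w} → w ≢ z → deg K w ≡ deg G (punchIn v w)
  residual-≢ {w} w≢z = begin
    deg K w                                ≡⟨ +-identityʳ _ ⟨
    deg K w + 0                            ≡⟨ cong (λ t → deg K w + ind t) (memberOf-∉ (z ∷ []) (w≢z ∘ singleton⁻)) ⟨
    deg K w + ind (memberOf (z ∷ []) w)    ≡⟨ deg-residual res w ⟩
    deg G (punchIn v w)                    ∎
    where open ≡-Reasoning

module _ {m} (5≤m : 5 ≤ m) (IH : Rearrangeable m) {G : Graph (suc m)} {v : Fin (suc m)}
  (3≤deg : ∀ w → 3 ≤ deg G w) (deg≡3 : deg G v ≡ 3) (large : 4 * suc m ≤ degSum G + 4) where

  -- In a good realization H of K, delete a spare edge ab and join v to a, b and z.
  realization-from-residual : ∀ {K z} → Residual K z G v → CopyRealization G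
  realization-from-residual {K} {z} res with IH K (residual-large res deg≡3 large)
  ... | H , H≈K , C with spare-edge {z = z} 5≤m C 3≤degH (residual-large resH deg≡3 large)
    where
    resH : Residual H z G v
    resH = residual-sameDegrees res H≈K
    3≤degH : ∀ w → w ≢ z → 3 ≤ deg H w
    3≤degH w w≢z = subst (3 ≤_) (sym (residual-≢ resH w≢z)) (3≤deg (punchIn v w))
  ... | a , b , a≢z , b≢z , ab , C′ =
    insertVertex v M H′ , insertVertex-sameDegrees v M H′ G count-M attach , copy-insertVertex v M C′
    where
    H′ = removeEdge a b (edge⇒≢ H ab) H
    M  = memberOf (a ∷ b ∷ z ∷ [])
    count-M : count M ≡ deg G v
    count-M = trans (count-memberOf ((edge⇒≢ H ab ∷ a≢z ∷ []) ∷ (b≢z ∷ []) ∷ [] ∷ [])) (sym deg≡3)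
    attach : ∀ w → deg H′ w + ind (M w) ≡ deg G (punchIn v w)
    attach w = trans (deg-removeEdge-memberOf H ab (a≢z ∘ singleton⁻) (b≢z ∘ singleton⁻) w)
                     (deg-residual (residual-sameDegrees res {H} H≈K) w)

residual-addEdge : ∀ {m} (G : Graph (suc m)) v (T : ExactlyThree (nbhd G v)) → let open ExactlyThree T in
  adj (deleteVertex v G) x y ≡ false → Residual (addEdge x y x≢y (deleteVertex v G)) z G v
residual-addEdge G v T xy = residual λ w → trans (exchange w) (deg-deleteVertex G v w)
  where
  open ExactlyThree T
  G∖v = deleteVertex v G
  K = addEdge x y x≢y G∖v
  open ≡-Reasoning
  z? = λ w → ind (memberOf (z ∷ []) w)
  exchange : ∀ w → deg K w + z? w ≡ deg G∖v w + ind (nbhd G v w)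
  exchange w with toSum (w ≟ᶠ x) | toSum (w ≟ᶠ y) | toSum (w ≟ᶠ z)
  ... | inj₁ refl | _ | _ = begin
    deg K x + z? x            ≡⟨ cong (λ t → deg K x + ind t) (memberOf-∉ (z ∷ []) (x≢z ∘ singleton⁻)) ⟩
    deg K x + 0               ≡⟨ +-identityʳ _ ⟩
    deg K x                   ≡⟨ deg-addEdge x≢y G∖v (inj₁ (refl , refl)) xy ⟩
    deg G∖v x + 1             ≡⟨ cong (λ t → deg G∖v x + ind t) gx ⟨
    deg G∖v x + ind (nbhd G v x) ∎
  ... | inj₂ _ | inj₁ refl | _ = begin
    deg K y + z? y            ≡⟨ cong (λ t → deg K y + ind t) (memberOf-∉ (z ∷ []) (y≢z ∘ singleton⁻)) ⟩
    deg K y + 0               ≡⟨ +-identityʳ _ ⟩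
    deg K y                   ≡⟨ deg-addEdge x≢y G∖v (inj₂ (refl , refl)) (trans (adj-sym G∖v y x) xy) ⟩
    deg G∖v y + 1             ≡⟨ cong (λ t → deg G∖v y + ind t) gy ⟨
    deg G∖v y + ind (nbhd G v y) ∎
  ... | inj₂ w≢x | inj₂ w≢y | inj₁ refl = cong₂ _+_ (deg-setEdge-off x≢y true G∖v w≢x w≢y)
    (cong ind (trans (memberOf-∈ (z ∷ []) (here refl)) (sym gz)))
  ... | inj₂ w≢x | inj₂ w≢y | inj₂ w≢z = cong₂ _+_ (deg-setEdge-off x≢y true G∖v w≢x w≢y)
    (cong ind (trans (memberOf-∉ (z ∷ []) (w≢z ∘ singleton⁻)) (sym (elsewhere-false T w≢x w≢y w≢z))))

module _ {m} (G : Graph (suc m)) (v : Fin (suc m)) (T : ExactlyThree (nbhd G v)) where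
  open ExactlyThree T

  private
    ↑≢ : ∀ {i j} → i ≢ j → punchIn v i ≢ punchIn v j
    ↑≢ {i} {j} i≢j = i≢j ∘ punchIn-injective v i j
    X = punchIn v x
    Y = punchIn v y
    Z = punchIn v z

  K4-pendant⇒copy : ∀ {q} → adj G X Y ≡ true → adj G X Z ≡ true → adj G Y Z ≡ true →
    adj G X q ≡ true → q ≢ v → q ≢ Y → q ≢ Z → Copy G
  K4-pendant⇒copy XY XZ YZ Xq q≢v q≢Y q≢Z =
    mkCopy _ X Y Z v (≢-sym (edge⇒≢ G Xq)) q≢Y q≢Z q≢v (↑≢ x≢y) (↑≢ x≢z) (punchInᵢ≢i v x)
      (↑≢ y≢z) (punchInᵢ≢i v y) (punchInᵢ≢i v z)
      YZ (edge-sym G gy) (edge-sym G XY) (edge-sym G gz) (edge-sym G XZ) Xq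

  Nv⊆ : ∀ q → adj G v q ≡ true → q ∈ v ∷ X ∷ Y ∷ Z ∷ []
  Nv⊆ q vq with ≡⊎punchIn v q
  ... | inj₁ refl with () ← trans (sym vq) (irref G v)
  ... | inj₂ (w , refl) with only w vq
  ...   | here refl                 = there (here refl)
  ...   | there (here refl)         = there (there (here refl))
  ...   | there (there (here refl)) = there (there (there (here refl)))

  -- The hypotheses make v X Y Z a K4 component; a 2-switch with an edge st outside it
  -- creates the pendant edge Xs.
  K4-switch : 4 ≤ m → (∀ w → 1 ≤ deg G w) → adj G X Y ≡ true → adj G X Z ≡ true → adj G Y Z ≡ true →
    (∀ q → adj G X q ≡ true → q ∈ v ∷ X ∷ Y ∷ Z ∷ []) → (∀ q → adj G Y q ≡ true → q ∈ v ∷ X ∷ Y ∷ Z ∷ []) →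
    (∀ q → adj G Z q ≡ true → q ∈ v ∷ X ∷ Y ∷ Z ∷ []) → CopyRealization G
  K4-switch 4≤m 1≤deg XY XZ YZ NX⊆ NY⊆ NZ⊆
    with outside (λ _ → true) (v ∷ X ∷ Y ∷ Z ∷ []) (subst (4 <_) (sym (count-true (suc m))) (s≤s 4≤m))
  ... | s , _ , s∉K with neighbour-outside G s [] (1≤deg s)
  ... | t , st , _ =
    switch X Y s t X≢Y s≢t X≢s Y≢t G ,
    switch-sameDegrees G X≢Y X≢s X≢t Y≢s Y≢t s≢t XY st (outside-non-adj (there (here refl)) s∉K)
      (outside-non-adj (there (there (here refl))) t∉K) ,
    mkCopy s X v Z Y s≢X s≢v s≢Z s≢Y (punchInᵢ≢i v x) X≢Z X≢Y (≢-sym (punchInᵢ≢i v z)) (≢-sym (punchInᵢ≢i v y)) (≢-sym Y≢Z)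
      (keep gz (¬OnEdge-apart X≢v X≢Z) (¬OnEdge-apart s≢v s≢Z))
      (keep gy (¬OnEdgeˡ (≢-sym X≢v) (≢-sym Y≢v)) (¬OnEdge-apart s≢v s≢Y))
      (keep gx (¬OnEdgeˡ (≢-sym X≢v) (≢-sym Y≢v)) (¬OnEdge-apart s≢v s≢X))
      (keep (edge-sym G YZ) (¬OnEdgeˡ (≢-sym X≢Z) (≢-sym Y≢Z)) (¬OnEdge-apart s≢Z s≢Y))
      (keep (edge-sym G XZ) (¬OnEdgeˡ (≢-sym X≢Z) (≢-sym Y≢Z)) (¬OnEdge-apart s≢Z s≢X))
      (switch-ac G X≢Y s≢t X≢s Y≢t)
    where
    K = v ∷ X ∷ Y ∷ Z ∷ []
    closed : ∀ {u} → u ∈ K → ∀ q → adj G u q ≡ true → q ∈ K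
    closed (here refl)                         = Nv⊆
    closed (there (here refl))                 = NX⊆
    closed (there (there (here refl)))         = NY⊆
    closed (there (there (there (here refl)))) = NZ⊆
    outside-non-adj : ∀ {u w} → u ∈ K → w ∉ K → adj G u w ≡ false
    outside-non-adj {u} {w} u∈K w∉K with adj G u w in uw
    ... | false = refl
    ... | true  = contradiction (closed u∈K w uw) w∉K
    t∉K : t ∉ K
    t∉K t∈K = s∉K (closed t∈K s (edge-sym G st))
    s≢v = s∉K ∘ here
    s≢X = s∉K ∘ there ∘ here
    s≢Y = s∉K ∘ there ∘ there ∘ here
    s≢Z = s∉K ∘ there ∘ there ∘ there ∘ here
    X≢s = ≢-sym s≢X
    Y≢s = ≢-sym s≢Y
    X≢t = t∉K ∘ there ∘ here ∘ sym
    Y≢t = t∉K ∘ there ∘ there ∘ here ∘ sym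
    s≢t = edge⇒≢ G st
    X≢Y = ↑≢ x≢y
    X≢Z = ↑≢ x≢z
    Y≢Z = ↑≢ y≢z
    X≢v = punchInᵢ≢i v x
    Y≢v = punchInᵢ≢i v y
    keep = switch-⊇ G X≢Y s≢t X≢s Y≢t

K4-case : ∀ {m} (G : Graph (suc m)) v (T : ExactlyThree (nbhd G v)) → let open ExactlyThree T in
  4 ≤ m → (∀ w → 1 ≤ deg G w) → adj G (punchIn v x) (punchIn v y) ≡ true →
  adj G (punchIn v x) (punchIn v z) ≡ true → adj G (punchIn v y) (punchIn v z) ≡ true → CopyRealization G
K4-case G v T 4≤m 1≤deg XY XZ YZ with outside? (adj G X) K | outside? (adj G Y) K | outside? (adj G Z) K
  where
  open ExactlyThree T
  X = punchIn v x
  Y = punchIn v y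
  Z = punchIn v z
  K = v ∷ X ∷ Y ∷ Z ∷ []
... | inj₁ (q , Xq , q∉K) | _ | _ = G , (λ _ → refl) ,
  K4-pendant⇒copy G v T XY XZ YZ Xq (q∉K ∘ here) (q∉K ∘ there ∘ there ∘ here) (q∉K ∘ there ∘ there ∘ there ∘ here)
... | inj₂ _ | inj₁ (q , Yq , q∉K) | _ = G , (λ _ → refl) ,
  K4-pendant⇒copy G v (rotate T) YZ (edge-sym G XY) (edge-sym G XZ) Yq
    (q∉K ∘ here) (q∉K ∘ there ∘ there ∘ there ∘ here) (q∉K ∘ there ∘ here)
... | inj₂ _ | inj₂ _ | inj₁ (q , Zq , q∉K) = G , (λ _ → refl) ,
  K4-pendant⇒copy G v (rotate (rotate T)) (edge-sym G XZ) (edge-sym G YZ) XY Zq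
    (q∉K ∘ here) (q∉K ∘ there ∘ here) (q∉K ∘ there ∘ there ∘ here)
... | inj₂ NX⊆ | inj₂ NY⊆ | inj₂ NZ⊆ = K4-switch G v T 4≤m 1≤deg XY XZ YZ NX⊆ NY⊆ NZ⊆

degree-three-case : ∀ {m} → 5 ≤ m → Rearrangeable m → (G : Graph (suc m)) (v : Fin (suc m)) →
  (∀ w → 3 ≤ deg G w) → deg G v ≡ 3 → 4 * suc m ≤ degSum G + 4 → ExactlyThree (nbhd G v) → CopyRealization G
degree-three-case 5≤m IH G v 3≤deg deg≡3 large T with adj G X Y in XY | adj G X Z in XZ | adj G Y Z in YZ
  where
  open ExactlyThree T
  X = punchIn v x
  Y = punchIn v y
  Z = punchIn v z
... | false | _     | _     = realization-from-residual 5≤m IH 3≤deg deg≡3 large (residual-addEdge G v T XY)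
... | true  | false | _     = realization-from-residual 5≤m IH 3≤deg deg≡3 large (residual-addEdge G v (swap-yz T) XZ)
... | true  | true  | false = realization-from-residual 5≤m IH 3≤deg deg≡3 large (residual-addEdge G v (rotate T) YZ)
... | true  | true  | true  = K4-case G v T (≤-trans (n≤1+n 4) 5≤m) (λ w → ≤-trans (s≤s z≤n) (3≤deg w)) XY XZ YZ

min-degree≡3 : ∀ {m S δ} → 1 ≤ m → 4 * suc m ≤ S + 2 * δ + 4 → S + 4 < 4 * m → suc m * δ ≤ S + 2 * δ → δ ≡ 3
min-degree≡3 {suc k} {S} {δ} _ large small min = ≤-antisym δ≤3 3≤δ
  where
  open ≤-Reasoning
  3≤δ : 3 ≤ δ
  3≤δ with 3 ≤? δ
  ... | yes 3≤δ = 3≤δ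
  ... | no  3≰δ = contradiction (begin-strict
    4 * suc (suc k)    ≤⟨ large ⟩
    S + 2 * δ + 4      ≤⟨ +-monoˡ-≤ 4 (+-monoʳ-≤ S (*-monoʳ-≤ 2 (≤-pred (≰⇒> 3≰δ)))) ⟩
    S + 4 + 4          <⟨ +-monoˡ-< 4 small ⟩
    4 * suc k + 4      ≡⟨ solve 1 (λ k → con 4 :* (con 1 :+ k) :+ con 4 := con 4 :* (con 2 :+ k)) refl k ⟩
    4 * suc (suc k)    ∎) (<-irrefl refl)
  kδ≤S : k * δ ≤ S
  kδ≤S = +-cancelˡ-≤ (2 * δ) (k * δ) S (begin
    2 * δ + k * δ      ≡⟨ solve 2 (λ k d → con 2 :* d :+ k :* d := (con 2 :+ k) :* d) refl k δ ⟩
    suc (suc k) * δ    ≤⟨ min ⟩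
    S + 2 * δ          ≡⟨ +-comm S (2 * δ) ⟩
    2 * δ + S          ∎)
  S<4k : S < 4 * k
  S<4k = +-cancelʳ-< 4 S (4 * k) (subst (S + 4 <_) (solve 1 (λ k → con 4 :* (con 1 :+ k) := con 4 :* k :+ con 4) refl k) small)
  δ≤3 : δ ≤ 3
  δ≤3 with δ ≤? 3
  ... | yes δ≤3 = δ≤3
  ... | no  δ≰3 = contradiction (begin-strict
    4 * k              ≤⟨ *-monoˡ-≤ k (≰⇒> δ≰3) ⟩
    δ * k              ≡⟨ *-comm δ k ⟩
    k * δ              ≤⟨ kδ≤S ⟩
    S                  <⟨ S<4k ⟩
    4 * k              ∎) (<-irrefl refl)

step : ∀ {m} → 5 ≤ m → Rearrangeable m → Rearrangeable (suc m)
step {m} 5≤m IH G large = from-min-degree-vertex (min-degree-vertex G)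
  where
  from-min-degree-vertex : (∃ λ v → ∀ w → deg G v ≤ deg G w) → CopyRealization G
  from-min-degree-vertex (v , min) with 4 * m ≤? degSum (deleteVertex v G) + 4
  ... | yes large′ = realization-by-deletion IH G v large′
  ... | no  small  = degree-three-case 5≤m IH G v 3≤deg deg≡3 large
                       (count≡3⇒ExactlyThree (trans (sym (deg≡count-nbhd G v)) deg≡3))
    where
    G∖v = deleteVertex v G
    large″ : 4 * suc m ≤ degSum G∖v + 2 * deg G v + 4
    large″ = subst (λ s → 4 * suc m ≤ s + 4) (degSum-deleteVertex G v) large
    min″ : suc m * deg G v ≤ degSum G∖v + 2 * deg G v
    min″ = subst (suc m * deg G v ≤_) (degSum-deleteVertex G v) (degSum≥ G min)
    deg≡3 : deg G v ≡ 3
    deg≡3 = min-degree≡3 (≤-trans (s≤s z≤n) 5≤m) large″ (≰⇒> small) min″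
    3≤deg : ∀ w → 3 ≤ deg G w
    3≤deg w = subst (_≤ deg G w) deg≡3 (min w)

-- Five vertices

-- A graph on five vertices is encoded by the ten bits of its adjacency matrix above the diagonal.
upperAdj : Vec Bool 10 → Fin 5 → Fin 5 → Bool
upperAdj bs 0F 1F = lookup bs (# 0)
upperAdj bs 0F 2F = lookup bs (# 1)
upperAdj bs 0F 3F = lookup bs (# 2)
upperAdj bs 0F 4F = lookup bs (# 3)
upperAdj bs 1F 2F = lookup bs (# 4)
upperAdj bs 1F 3F = lookup bs (# 5)
upperAdj bs 1F 4F = lookup bs (# 6)
upperAdj bs 2F 3F = lookup bs (# 7)
upperAdj bs 2F 4F = lookup bs (# 8)
upperAdj bs 3F 4F = lookup bs (# 9)
upperAdj bs _  _  = false

upperAdj-irref : ∀ bs i → upperAdj bs i i ≡ false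
upperAdj-irref bs 0F = refl
upperAdj-irref bs 1F = refl
upperAdj-irref bs 2F = refl
upperAdj-irref bs 3F = refl
upperAdj-irref bs 4F = refl

fromBits : Vec Bool 10 → Graph 5
fromBits bs = record
  { adj   = λ i j → upperAdj bs i j ∨ upperAdj bs j i
  ; sym   = λ i j → ∨-comm (upperAdj bs i j) (upperAdj bs j i)
  ; irref = λ i → cong₂ _∨_ (upperAdj-irref bs i) (upperAdj-irref bs i)
  }

toBits : Graph 5 → Vec Bool 10
toBits G = adj G 0F 1F ∷ adj G 0F 2F ∷ adj G 0F 3F ∷ adj G 0F 4F ∷ adj G 1F 2F ∷
           adj G 1F 3F ∷ adj G 1F 4F ∷ adj G 2F 3F ∷ adj G 2F 4F ∷ adj G 3F 4F ∷ []

fromBits-toBits : ∀ G i j → adj (fromBits (toBits G)) i j ≡ adj G i j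
fromBits-toBits G 0F 0F = sym (irref G 0F)
fromBits-toBits G 0F 1F = ∨-identityʳ _
fromBits-toBits G 0F 2F = ∨-identityʳ _
fromBits-toBits G 0F 3F = ∨-identityʳ _
fromBits-toBits G 0F 4F = ∨-identityʳ _
fromBits-toBits G 1F 0F = adj-sym G 0F 1F
fromBits-toBits G 1F 1F = sym (irref G 1F)
fromBits-toBits G 1F 2F = ∨-identityʳ _
fromBits-toBits G 1F 3F = ∨-identityʳ _
fromBits-toBits G 1F 4F = ∨-identityʳ _
fromBits-toBits G 2F 0F = adj-sym G 0F 2F
fromBits-toBits G 2F 1F = adj-sym G 1F 2F
fromBits-toBits G 2F 2F = sym (irref G 2F)
fromBits-toBits G 2F 3F = ∨-identityʳ _
fromBits-toBits G 2F 4F = ∨-identityʳ _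
fromBits-toBits G 3F 0F = adj-sym G 0F 3F
fromBits-toBits G 3F 1F = adj-sym G 1F 3F
fromBits-toBits G 3F 2F = adj-sym G 2F 3F
fromBits-toBits G 3F 3F = sym (irref G 3F)
fromBits-toBits G 3F 4F = ∨-identityʳ _
fromBits-toBits G 4F 0F = adj-sym G 0F 4F
fromBits-toBits G 4F 1F = adj-sym G 1F 4F
fromBits-toBits G 4F 2F = adj-sym G 2F 4F
fromBits-toBits G 4F 3F = adj-sym G 3F 4F
fromBits-toBits G 4F 4F = sym (irref G 4F)

copyAt : (H : Graph 5) → Fin 5 × Fin 5 × Fin 5 × Fin 5 × Fin 5 → Maybe (Copy H)
copyAt H (p , x , s₁ , s₂ , c)
  with p ≟ᶠ x | p ≟ᶠ s₁ | p ≟ᶠ s₂ | p ≟ᶠ c | x ≟ᶠ s₁ | x ≟ᶠ s₂ | x ≟ᶠ c | s₁ ≟ᶠ s₂ | s₁ ≟ᶠ c | s₂ ≟ᶠ c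
     | adj H s₁ s₂ ≟ᵇ true | adj H s₁ c ≟ᵇ true | adj H s₁ x ≟ᵇ true | adj H s₂ c ≟ᵇ true | adj H s₂ x ≟ᵇ true
     | adj H x p ≟ᵇ true
... | no d₁ | no d₂ | no d₃ | no d₄ | no d₅ | no d₆ | no d₇ | no d₈ | no d₉ | no d₁₀
    | yes e₁ | yes e₂ | yes e₃ | yes e₄ | yes e₅ | yes e₆ =
  just (mkCopy p x s₁ s₂ c d₁ d₂ d₃ d₄ d₅ d₆ d₇ d₈ d₉ d₁₀ e₁ e₂ e₃ e₄ e₅ e₆)
... | _ | _ | _ | _ | _ | _ | _ | _ | _ | _ | _ | _ | _ | _ | _ | _ = nothing

findCopy : (H : Graph 5) → Maybe (Copy H)
findCopy H = head (mapMaybe (copyAt H) candidates)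
  where
  candidates = cartesianProduct (allFin 5) (cartesianProduct (allFin 5)
                 (cartesianProduct (allFin 5) (cartesianProduct (allFin 5) (allFin 5))))

copyIfLarge : (bs : Vec Bool 10) → Bool
copyIfLarge bs = if does (20 ≤? degSum (fromBits bs) + 4) then is-just (findCopy (fromBits bs)) else true

allBits : ∀ k → (Vec Bool k → Bool) → Bool
allBits zero    f = f []
allBits (suc k) f = allBits k (f ∘ (true ∷_)) ∧ allBits k (f ∘ (false ∷_))

allBits-sound : ∀ k (f : Vec Bool k → Bool) → T (allBits k f) → ∀ bs → T (f bs)
allBits-sound zero    f ok []       = ok
allBits-sound (suc k) f ok (b ∷ bs)
  with Equivalence.to (T-∧ {allBits k (f ∘ (true ∷_))} {allBits k (f ∘ (false ∷_))}) ok
allBits-sound (suc k) f ok (true  ∷ bs) | okᵗ , _ = allBits-sound k (f ∘ (true ∷_)) okᵗ bs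
allBits-sound (suc k) f ok (false ∷ bs) | _ , okᶠ = allBits-sound k (f ∘ (false ∷_)) okᶠ bs

allBits-copyIfLarge : T (allBits 10 copyIfLarge)
allBits-copyIfLarge = tt

from-check : ∀ {P A : Set} (p? : Dec P) (ma : Maybe A) → T (if does p? then is-just ma else true) → P → A
from-check (yes _)  (just a) _ _ = a
from-check (no ¬p)  _        _ p = contradiction p ¬p

rearrangeable-5 : Rearrangeable 5
rearrangeable-5 G large = G , (λ _ → refl) , copy-transport (fromBits-toBits G) copy
  where
  H = fromBits (toBits G)
  large′ : 20 ≤ degSum H + 4
  large′ = subst (λ s → 20 ≤ s + 4)
    (sum-cong-≗ (≗adj⇒SameDegrees {G = G} {H} (λ i j → sym (fromBits-toBits G i j)))) large
  copy : Copy H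
  copy = from-check (20 ≤? degSum H + 4) (findCopy H)
    (allBits-sound 10 copyIfLarge allBits-copyIfLarge (toBits G)) large′

rearrangeable : ∀ {n} → 5 ≤′ n → Rearrangeable n
rearrangeable ≤′-refl         = rearrangeable-5
rearrangeable (≤′-step 5≤′n) = step (≤′⇒≤ 5≤′n) (rearrangeable 5≤′n)

-- The book graph

bookAdj : ∀ m → Fin (suc (suc m)) → Fin (suc (suc m)) → Bool
bookAdj m zero          zero          = false
bookAdj m zero          (suc _)       = true
bookAdj m (suc zero)    zero          = true
bookAdj m (suc zero)    (suc zero)    = false
bookAdj m (suc zero)    (suc (suc _)) = true
bookAdj m (suc (suc _)) zero          = true
bookAdj m (suc (suc _)) (suc zero)    = true
bookAdj m (suc (suc _)) (suc (suc _)) = false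

book : ∀ m → Graph (suc (suc m))
book m = record { adj = bookAdj m ; sym = bookAdj-sym ; irref = bookAdj-irref }
  where
  bookAdj-sym : ∀ i j → bookAdj m i j ≡ bookAdj m j i
  bookAdj-sym zero          zero          = refl
  bookAdj-sym zero          (suc zero)    = refl
  bookAdj-sym zero          (suc (suc _)) = refl
  bookAdj-sym (suc zero)    zero          = refl
  bookAdj-sym (suc zero)    (suc zero)    = refl
  bookAdj-sym (suc zero)    (suc (suc _)) = refl
  bookAdj-sym (suc (suc _)) zero          = refl
  bookAdj-sym (suc (suc _)) (suc zero)    = refl
  bookAdj-sym (suc (suc _)) (suc (suc _)) = refl
  bookAdj-irref : ∀ i → bookAdj m i i ≡ false
  bookAdj-irref zero          = refl
  bookAdj-irref (suc zero)    = refl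
  bookAdj-irref (suc (suc _)) = refl

bookDegrees : ∀ m → Seq (suc (suc m))
bookDegrees m zero          = suc m
bookDegrees m (suc zero)    = suc m
bookDegrees m (suc (suc _)) = 2

book-realizes : ∀ m → Realizes (book m) (bookDegrees m)
book-realizes m i = trans (deg≡count (book m) i) (count-row i)
  where
  count-row : ∀ i → count (bookAdj m i) ≡ bookDegrees m i
  count-row zero          = cong suc (count-true m)
  count-row (suc zero)    = cong suc (count-true m)
  count-row (suc (suc _)) = cong (λ k → suc (suc k)) (trans (sum-const m 0) (*-zeroʳ m))

bookDegrees-graphic : ∀ m → Graphic (bookDegrees m)
bookDegrees-graphic m = nonincreasing , book m , book-realizes m
  where
  2≤suc : ∀ {k} → Fin k → 2 ≤ suc k
  2≤suc zero    = s≤s (s≤s z≤n)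
  2≤suc (suc _) = s≤s (s≤s z≤n)
  nonincreasing : Nonincreasing (bookDegrees m)
  nonincreasing zero          zero          _           = ≤-refl
  nonincreasing zero          (suc zero)    _           = ≤-refl
  nonincreasing (suc zero)    (suc zero)    _           = ≤-refl
  nonincreasing (suc (suc _)) (suc (suc _)) _           = ≤-refl
  nonincreasing (suc zero)    zero          ()
  nonincreasing (suc (suc _)) zero          ()
  nonincreasing (suc (suc _)) (suc zero)    (s≤s ())
  nonincreasing zero          (suc (suc j)) _           = 2≤suc j
  nonincreasing (suc zero)    (suc (suc j)) _           = 2≤suc j

bookDegrees-positive : ∀ m → AllPositive (bookDegrees m)
bookDegrees-positive m zero          = s≤s z≤n
bookDegrees-positive m (suc zero)    = s≤s z≤n
bookDegrees-positive m (suc (suc _)) = s≤s z≤n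

σ-bookDegrees : ∀ m → σ (bookDegrees m) ≡ suc (2 * m) * 2
σ-bookDegrees m = begin
  σ (bookDegrees m)                ≡⟨ sum-map-allFin (bookDegrees m) ⟩
  suc m + (suc m + ∑[ i < m ] 2)   ≡⟨ cong (λ s → suc m + (suc m + s)) (sum-const m 2) ⟩
  suc m + (suc m + m * 2)          ≡⟨ solve 1 (λ m → (con 1 :+ m) :+ ((con 1 :+ m) :+ m :* con 2)
                                                   := (con 1 :+ con 2 :* m) :* con 2) refl m ⟩
  suc (2 * m) * 2                  ∎
  where open ≡-Reasoning

-- x, s₁ and s₂ of a copy have degree at least 3, but only the two spine vertices of a book do.
bookDegrees-not-potentially : ∀ m → ¬ PotentiallyGraphic K5-Y4 (bookDegrees m)
bookDegrees-not-potentially m (_ , G , G-realizes , f , injective , edges) =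
  no-three-among-two (f≢ (λ ())) (f≢ (λ ())) (f≢ (λ ()))
    (spine (three-neighbours⇒3≤deg G (f≢ (λ ())) (f≢ (λ ())) (f≢ (λ ())) (edges 4F 0F refl) (edges 4F 1F refl) (edges 4F 2F refl)))
    (spine (three-neighbours⇒3≤deg G (f≢ (λ ())) (f≢ (λ ())) (f≢ (λ ())) (edges 1F 2F refl) (edges 1F 3F refl) (edges 1F 4F refl)))
    (spine (three-neighbours⇒3≤deg G (f≢ (λ ())) (f≢ (λ ())) (f≢ (λ ())) (edges 2F 1F refl) (edges 2F 3F refl) (edges 2F 4F refl)))
  where
  f≢ : ∀ {i j} → i ≢ j → f i ≢ f j
  f≢ i≢j = i≢j ∘ injective
  spine : ∀ {w} → 3 ≤ deg G w → w ≡ zero ⊎ w ≡ suc zero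
  spine {zero}        _     = inj₁ refl
  spine {suc zero}    _     = inj₂ refl
  spine {suc (suc j)} 3≤deg = contradiction (subst (3 ≤_) (G-realizes (suc (suc j))) 3≤deg) λ { (s≤s (s≤s ())) }

4n∸4-even : ∀ n → Even (4 * n ∸ 4)
4n∸4-even n = divides (2 * n ∸ 2) (begin
  4 * n ∸ 4            ≡⟨ cong (_∸ 4) (solve 1 (λ n → con 4 :* n := con 2 :* n :* con 2) refl n) ⟩
  2 * n * 2 ∸ 2 * 2    ≡⟨ *-distribʳ-∸ 2 (2 * n) 2 ⟨
  (2 * n ∸ 2) * 2      ∎)
  where open ≡-Reasoning

K5-Y4-sigmaProperty : ∀ {n} → 5 ≤ n → SigmaProperty K5-Y4 n (4 * n ∸ 4)
K5-Y4-sigmaProperty {n} 5≤n d graphic@(_ , G , G-realizes) _ bound with rearrangeable (≤⇒≤′ 5≤n) G large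
  where
  large : 4 * n ≤ degSum G + 4
  large = begin
    4 * n                  ≡⟨ m∸n+n≡m (*-monoʳ-≤ 4 (≤-trans (s≤s z≤n) 5≤n)) ⟨
    4 * n ∸ 4 + 4          ≤⟨ +-monoˡ-≤ 4 bound ⟩
    σ d + 4                ≡⟨ cong (_+ 4) (trans (sum-map-allFin d) (sum-cong-≗ (sym ∘ G-realizes))) ⟩
    degSum G + 4           ∎
    where open ≤-Reasoning
... | H , H≈G , C = graphic , H , (λ i → trans (H≈G i) (G-realizes i)) , copy⇒subgraph C

K5-Y4-sigmaProperty-sharp : ∀ {n} → 2 ≤ n → ∀ m′ → Even m′ → m′ < 4 * n ∸ 4 → ¬ SigmaProperty K5-Y4 n m′
K5-Y4-sigmaProperty-sharp {suc (suc m)} _ _ (divides q refl) q*2<bound property =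
  bookDegrees-not-potentially m
    (property (bookDegrees m) (bookDegrees-graphic m) (bookDegrees-positive m) (subst (q * 2 ≤_) (sym (σ-bookDegrees m)) q*2≤))
  where
  bound≡ : 4 * suc (suc m) ∸ 4 ≡ suc (suc (2 * m)) * 2
  bound≡ = trans (cong (_∸ 4) (solve 1 (λ m → con 4 :* (con 2 :+ m) := (con 2 :+ con 2 :* m) :* con 2 :+ con 4) refl m))
                 (m+n∸n≡m _ 4)
  q*2≤ : q * 2 ≤ suc (2 * m) * 2
  q*2≤ = *-monoˡ-≤ 2 (≤-pred (*-cancelʳ-< 2 q (suc (suc (2 * m))) (subst (q * 2 <_) bound≡ q*2<bound)))

corollary2p4 : ∀ (n : ℕ) → 5 ≤ n → IsSigma K5-Y4 n (4 * n ∸ 4)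
corollary2p4 n 5≤n = 4n∸4-even n , K5-Y4-sigmaProperty 5≤n , K5-Y4-sigmaProperty-sharp (≤-trans (s≤s (s≤s z≤n)) 5≤n)
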